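{- Let $\Sigma$ be a HIT-signature and let $X$ be an algebra for $\Sigma$ (in 1-types). Then $X$ is a 1-truncated higher inductive type for $\Sigma$ (i.e. every displayed algebra over $X$ has a section) if and only if $X$ is a biinitial object of the bicategory $\mathrm{Alg}(\Sigma)$.
   Context: Work in homotopy type theory with univalence (hence function extensionality). A 1-type is a type all of whose identity types are sets. Composition of maps/1-cells is written in diagrammatic order. An object $x$ of a bicategory is biinitial if for every object $y$ there is a 1-cell $x\to y$, between any two 1-cells $x\to y$ there is a 2-cell, and any two 2-cells between the same 1-cells $x\to y$ are equal. Polynomial codes are generated by $C_Z$ ($Z$ a 1-type), $\mathsf{Id}$, $P_1+P_2$, $P_1\times P_2$; they act on types by $C_Z(Y)=Z$, $\mathsf{Id}(Y)=Y$, $(P_1+P_2)(Y)=P_1(Y)+P_2(Y)$, $(P_1\times P_2)(Y)=P_1(Y)\times P_2(Y)$, and functorially on maps and homotopies. For codes $A,S,T$, path endpoints $\mathrm{PE}_A(S,T)$ are inductively generated by: $\mathsf{id}:\mathrm{PE}_A(P,P)$; $e_1\cdot e_2:\mathrm{PE}_A(P,R)$ for $e_1:\mathrm{PE}_A(P,Q)$, $e_2:\mathrm{PE}_A(Q,R)$; $\mathsf{constr}:\mathrm{PE}_A(A,\mathsf{Id})$; $\mathsf{inl}:\mathrm{PE}_A(P,P+Q)$; $\mathsf{inr}:\mathrm{PE}_A(Q,P+Q)$; $\mathsf{pr}_1:\mathrm{PE}_A(P\times Q,P)$; $\mathsf{pr}_2:\mathrm{PE}_A(P\times Q,Q)$;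 $\langle e_1,e_2\rangle:\mathrm{PE}_A(P,Q\times R)$; $\mathsf{C}(z):\mathrm{PE}_A(P,C_Z)$ for $z:Z$; $\mathsf{fmap}(f):\mathrm{PE}_A(C_Z,C_{Z'})$ for $f:Z\to Z'$. Given a type $X$ with $c:A(X)\to X$, each $e:\mathrm{PE}_A(S,T)$ is interpreted by recursion as a map $[\![e]\!]:S(X)\to T(X)$ (identity, composition, $c$, injections, projections, pairing, constant $z$, $f$). Homotopy endpoints: fix a code $A$, a type $J$ with codes $Q_j$ and $l_j,r_j:\mathrm{PE}_A(Q_j,\mathsf{Id})$, a code $R$, a code $T$ with $a,b:\mathrm{PE}_A(R,T)$. For $s,t:\mathrm{PE}_A(R,W)$ the type $\mathrm{HE}(s,t)$ is inductively generated by: $\mathsf{refl}(e):\mathrm{HE}(e,e)$; inverses $h^{ -1}$; concatenation $h_1\bullet h_2$; $\mathsf{ap}(e,h):\mathrm{HE}(e_1\cdot e,e_2\cdot e)$ for $h:\mathrm{HE}(e_1,e_2)$; an associator in $\mathrm{HE}(e_1\cdot(e_2\cdot e_3),(e_1\cdot e_2)\cdot e_3)$; unitors in $\mathrm{HE}(\mathsf{id}\cdot e,e)$ and $\mathrm{HE}(e\cdot\mathsf{id},e)$; elements of $\mathrm{HE}(\langle e_1,e_2\rangle\cdot\mathsf{pr}_i,e_i)$; pairing $\mathrm{HE}(\langle e_1,e_3\rangle,\langle e_2,e_4\rangle)$ from $\mathrm{HE}(e_1,e_2)$ and $\mathrm{HE}(e_3,e_4)$; an element of $\mathrm{HE}(e_1\cdot\langle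 e_2,e_3\rangle,\langle e_1\cdot e_2,e_1\cdot e_3\rangle)$; an element of $\mathrm{HE}(e\cdot\mathsf{C}(z),\mathsf{C}(z))$; $\mathsf{path}(j,e):\mathrm{HE}(e\cdot l_j,e\cdot r_j)$ for $e:\mathrm{PE}_A(R,Q_j)$; $\mathsf{arg}:\mathrm{HE}(a,b)$. Given $(X,c)$ and paths $p_j(x):[\![l_j]\!](x)=[\![r_j]\!](x)$, each $h:\mathrm{HE}(s,t)$ yields for $x:R(X)$ and $w:[\![a]\!](x)=[\![b]\!](x)$ a path $[\![h]\!](x,w):[\![s]\!](x)=[\![t]\!](x)$ by recursion (reflexivity, inverse, concatenation, action of $[\![e]\!]$ on paths; associator, unitor, projection, composition-pair and constant cases are reflexivity; pairing of paths; $\mathsf{path}(j,e)\mapsto p_j([\![e]\!](x))$; $\mathsf{arg}\mapsto w$). A HIT-signature $\Sigma$ consists of a code $A$; a type $J$ with codes $Q_j$ and $l_j,r_j:\mathrm{PE}_A(Q_j,\mathsf{Id})$; a type $K$ with, for each $k$, codes $R_k,T_k$, endpoints $a_k,b_k:\mathrm{PE}_A(R_k,T_k)$, $s_k,t_k:\mathrm{PE}_A(R_k,\mathsf{Id})$, and homotopy endpoints $h_k,h'_k:\mathrm{HE}(s_k,t_k)$ (relative to $l,r,a_k,b_k$). The bicategory $\mathrm{Alg}(\Sigma)$: an object (algebra) is a 1-type $X$ with $c_X:A(X)\to X$, paths $p^X_j(x):[\![l_j]\!](x)=[\![r_j]\!](x)$ for $x:Q_j(X)$, such that $[\![h_k]\!](x,w)=[\![h'_k]\!](x,w)$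 for all $k$, $x:R_k(X)$, $w:[\![a_k]\!](x)=[\![b_k]\!](x)$. A 1-cell $X\to Y$ is a map $f$ with paths $f_c(x):f(c_X(x))=c_Y(A(f)(x))$ and, for all $j,x$, an equality $\mathsf{ap}_f(p^X_j(x))\bullet[\![r_j]\!](f)(x)=[\![l_j]\!](f)(x)\bullet p^Y_j(Q_j(f)(x))$, where for $e:\mathrm{PE}_A(S,\mathsf{Id})$ the path $[\![e]\!](f)(x):f([\![e]\!](x))=[\![e]\!](S(f)(x))$ is built from $f_c$ by recursion on $e$. A 2-cell $f\Rightarrow g$ is a homotopy $\theta$ with $\theta(c_X(x))\bullet g_c(x)=f_c(x)\bullet\mathsf{ap}_{c_Y}(A(\theta)(x))$. Identities and composition are the evident ones. Dependent structure: for a family $Y$ over $X$ and a code $P$, $\overline{P}(Y)$ is the family over $P(X)$ with $\overline{C_Z}(Y)(z)=\mathbf{1}$, $\overline{\mathsf{Id}}(Y)=Y$, sums casewise, products componentwise; $f:\prod_x Y(x)$ induces $\overline{P}(f):\prod_{x:P(X)}\overline{P}(Y)(x)$. For a path $p:x_1=x_2$ and $\bar x_i:Y(x_i)$, the type of paths over $p$ is defined by path induction (over $\mathsf{refl}$ it is $\bar x_1=\bar x_2$); for a 2-path $g:p=q$ and paths $\bar p,\bar q$ over $p,q$, globes over $g$ are defined by path induction (over $\mathsf{refl}_p$ they are $\bar p=\bar q$); and given additionally $h_1:\bar x_1=\bar x_1'$, $h_2:\bar x_2=\bar x_2'$ and $\bar p$ over $p$ from $\bar x_1$ to $\bar x_2$,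 $\bar q$ over $q$ from $\bar x_1'$ to $\bar x_2'$, squares over $g$ from $\bar p$ to $\bar q$ with sides $h_1,h_2$ are defined by path induction on $g$ (over reflexivity: $\bar p\bullet h_2=h_1\bullet\bar q$). Given $c_Y:\prod_{x:A(X)}\overline{A}(Y)(x)\to Y(c_X(x))$, every endpoint $e:\mathrm{PE}_A(S,T)$ has a dependent interpretation $\overline{[\![e]\!]}:\overline{S}(Y)(x)\to\overline{T}(Y)([\![e]\!](x))$ by the analogous recursion, with a canonical path $\overline{T}(f)([\![e]\!](x))=\overline{[\![e]\!]}(\overline{S}(f)(x))$ whenever $f$ commutes with $c_X,c_Y$; and given paths $\bar p_j$ over $p_j$, every homotopy endpoint $h$ has a dependent interpretation sending $\bar x,\bar w$ (over $x,w$) to a path over $[\![h]\!](x,w)$, by the analogous recursion. A displayed algebra over an algebra $X$ is: a family $Y$ of 1-types over $X$; maps $c_Y:\overline{A}(Y)(x)\to Y(c_X(x))$; for all $j$, $x$, $\bar x$ a path over $p^X_j(x)$ from $\overline{[\![l_j]\!]}(\bar x)$ to $\overline{[\![r_j]\!]}(\bar x)$; for all $k$, $x,\bar x,w,\bar w$ a globe over the homotopy equation of $X$ between the dependent interpretations of $h_k$ and $h'_k$. A section of $Y$ is $f:\prod_{x:X}Y(x)$ with paths $f(c_X(x))=c_Y(\overline{A}(f)(x))$ and, for all $j$ and $x:Q_j(X)$, a square from $\mathsf{apd}_f(p^X_j(x))$ to the displayed path at $\overline{Q_j}(f)(x)$ whose sides are the canonical paths for $l_j$ and $r_j$. -}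

{-# OPTIONS --without-K #-}
module Defs where

open import Level using (Level; _⊔_)
open import Data.Unit using (⊤; tt)
open import Data.Product using (Σ; _×_; _,_; proj₁; proj₂)
open import Data.Sum using (_⊎_; inj₁; inj₂)
open import Relation.Binary.PropositionalEquality using (_≡_; refl; sym; trans; cong; cong₂)

isContr : ∀ {ℓ} → Set ℓ → Set ℓ
isContr A = Σ A λ a → ∀ b → a ≡ b

isProp : ∀ {ℓ} → Set ℓ → Set ℓ
isProp A = (a b : A) → a ≡ b

isSet : ∀ {ℓ} → Set ℓ → Set ℓ
isSet A = (a b : A) → isProp (a ≡ b)

is1Type : ∀ {ℓ} → Set ℓ → Set ℓ
is1Type A = (a b : A) → isSet (a ≡ b)

fiber : ∀ {ℓ ℓ'} {A : Set ℓ} {B : Set ℓ'} → (A → B) → B → Set (ℓ ⊔ ℓ')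
fiber {A = A} f y = Σ A λ x → f x ≡ y

isEquiv : ∀ {ℓ ℓ'} {A : Set ℓ} {B : Set ℓ'} → (A → B) → Set (ℓ ⊔ ℓ')
isEquiv f = ∀ y → isContr (fiber f y)

_≃_ : ∀ {ℓ ℓ'} → Set ℓ → Set ℓ' → Set (ℓ ⊔ ℓ')
A ≃ B = Σ (A → B) isEquiv

idtoeqv : ∀ {ℓ} {A B : Set ℓ} → A ≡ B → A ≃ B
idtoeqv refl = (λ x → x) , λ y → (y , refl) , λ { (x , refl) → refl }

Univalence : (ℓ : Level) → Set (Level.suc ℓ)
Univalence ℓ = (A B : Set ℓ) → isEquiv (idtoeqv {A = A} {B = B})

PathOver : {T : Set} (B : T → Set) {t₁ t₂ : T} → t₁ ≡ t₂ → B t₁ → B t₂ → Set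
PathOver B refl b₁ b₂ = b₁ ≡ b₂

apd : {T : Set} {B : T → Set} (f : (t : T) → B t) {t₁ t₂ : T} (p : t₁ ≡ t₂) →
      PathOver B p (f t₁) (f t₂)
apd f refl = refl

GlobeOver : {T : Set} (B : T → Set) {t₁ t₂ : T} {p q : t₁ ≡ t₂} (g : p ≡ q)
            {b₁ : B t₁} {b₂ : B t₂} → PathOver B p b₁ b₂ → PathOver B q b₁ b₂ → Set
GlobeOver B refl pb qb = pb ≡ qb

_∙o_ : {T : Set} {B : T → Set} {t₁ t₂ : T} {p : t₁ ≡ t₂} {b₁ : B t₁} {b₂ b₂' : B t₂} →
       PathOver B p b₁ b₂ → b₂ ≡ b₂' → PathOver B p b₁ b₂'
pb ∙o refl = pb

_o∙_ : {T : Set} {B : T → Set} {t₁ t₂ : T} {p : t₁ ≡ t₂} {b₁ b₁' : B t₁} {b₂ : B t₂} →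
       b₁ ≡ b₁' → PathOver B p b₁' b₂ → PathOver B p b₁ b₂
refl o∙ qb = qb

SquareOver : {T : Set} (B : T → Set) {t₁ t₂ : T} {p q : t₁ ≡ t₂} (g : p ≡ q)
             {b₁ b₁' : B t₁} {b₂ b₂' : B t₂} (h₁ : b₁ ≡ b₁') (h₂ : b₂ ≡ b₂') →
             PathOver B p b₁ b₂ → PathOver B q b₁' b₂' → Set
SquareOver B refl h₁ h₂ pb qb = (pb ∙o h₂) ≡ (h₁ o∙ qb)

dsym : {T : Set} {B : T → Set} {t₁ t₂ : T} {p : t₁ ≡ t₂} {b₁ : B t₁} {b₂ : B t₂} →
       PathOver B p b₁ b₂ → PathOver B (sym p) b₂ b₁
dsym {p = refl} pb = sym pb

dtrans : {T : Set} {B : T → Set} {t₁ t₂ t₃ : T} {p : t₁ ≡ t₂} {q : t₂ ≡ t₃}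
         {b₁ : B t₁} {b₂ : B t₂} {b₃ : B t₃} →
         PathOver B p b₁ b₂ → PathOver B q b₂ b₃ → PathOver B (trans p q) b₁ b₃
dtrans {p = refl} {q = refl} pb qb = trans pb qb

dap : {T T' : Set} {B : T → Set} {B' : T' → Set} (F : T → T') (G : (t : T) → B t → B' (F t))
      {t₁ t₂ : T} {p : t₁ ≡ t₂} {b₁ : B t₁} {b₂ : B t₂} →
      PathOver B p b₁ b₂ → PathOver B' (cong F p) (G t₁ b₁) (G t₂ b₂)
dap F G {p = refl} pb = cong (G _) pb

dpair : {T₁ T₂ : Set} {B₁ : T₁ → Set} {B₂ : T₂ → Set}
        {s₁ s₂ : T₁} {t₁ t₂ : T₂} {p : s₁ ≡ s₂} {q : t₁ ≡ t₂}
        {b₁ : B₁ s₁} {b₂ : B₁ s₂} {c₁ : B₂ t₁} {c₂ : B₂ t₂} →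
        PathOver B₁ p b₁ b₂ → PathOver B₂ q c₁ c₂ →
        PathOver (λ x → B₁ (proj₁ x) × B₂ (proj₂ x)) (cong₂ _,_ p q) (b₁ , c₁) (b₂ , c₂)
dpair {p = refl} {q = refl} pb qb = cong₂ _,_ pb qb

infixr 5 _⊕_
infixr 6 _⊗_

data Code : Set₁ where
  C   : (Z : Set) → is1Type Z → Code
  I   : Code
  _⊕_ : Code → Code → Code
  _⊗_ : Code → Code → Code

⟦_⟧ : Code → Set → Set
⟦ C Z _ ⟧ Y = Z
⟦ I ⟧ Y = Y
⟦ P ⊕ Q ⟧ Y = ⟦ P ⟧ Y ⊎ ⟦ Q ⟧ Y
⟦ P ⊗ Q ⟧ Y = ⟦ P ⟧ Y × ⟦ Q ⟧ Y

fmap : (P : Code) {X Y : Set} → (X → Y) → ⟦ P ⟧ X → ⟦ P ⟧ Y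
fmap (C Z _) f z = z
fmap I f x = f x
fmap (P ⊕ Q) f (inj₁ x) = inj₁ (fmap P f x)
fmap (P ⊕ Q) f (inj₂ x) = inj₂ (fmap Q f x)
fmap (P ⊗ Q) f x = fmap P f (proj₁ x) , fmap Q f (proj₂ x)

fmapH : (P : Code) {X Y : Set} {f g : X → Y} → (∀ x → f x ≡ g x) →
        ∀ x → fmap P f x ≡ fmap P g x
fmapH (C Z _) θ z = refl
fmapH I θ x = θ x
fmapH (P ⊕ Q) θ (inj₁ x) = cong inj₁ (fmapH P θ x)
fmapH (P ⊕ Q) θ (inj₂ x) = cong inj₂ (fmapH Q θ x)
fmapH (P ⊗ Q) θ x = cong₂ _,_ (fmapH P θ (proj₁ x)) (fmapH Q θ (proj₂ x))

D⟦_⟧ : (P : Code) {X : Set} (Y : X → Set) → ⟦ P ⟧ X → Set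
D⟦ C Z _ ⟧ Y _ = ⊤
D⟦ I ⟧ Y x = Y x
D⟦ P ⊕ Q ⟧ Y (inj₁ x) = D⟦ P ⟧ Y x
D⟦ P ⊕ Q ⟧ Y (inj₂ x) = D⟦ Q ⟧ Y x
D⟦ P ⊗ Q ⟧ Y x = D⟦ P ⟧ Y (proj₁ x) × D⟦ Q ⟧ Y (proj₂ x)

dfmap : (P : Code) {X : Set} {Y : X → Set} (f : (x : X) → Y x) (x : ⟦ P ⟧ X) → D⟦ P ⟧ Y x
dfmap (C Z _) f z = tt
dfmap I f x = f x
dfmap (P ⊕ Q) f (inj₁ x) = dfmap P f x
dfmap (P ⊕ Q) f (inj₂ x) = dfmap Q f x
dfmap (P ⊗ Q) f x = dfmap P f (proj₁ x) , dfmap Q f (proj₂ x)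

infixl 5 _·_

data PE (A : Code) : Code → Code → Set₁ where
  id     : ∀ {P} → PE A P P
  _·_    : ∀ {P Q R} → PE A P Q → PE A Q R → PE A P R
  constr : PE A A I
  inl    : ∀ {P Q} → PE A P (P ⊕ Q)
  inr    : ∀ {P Q} → PE A Q (P ⊕ Q)
  pr₁    : ∀ {P Q} → PE A (P ⊗ Q) P
  pr₂    : ∀ {P Q} → PE A (P ⊗ Q) Q
  ⟨_,_⟩  : ∀ {P Q R} → PE A P Q → PE A P R → PE A P (Q ⊗ R)
  cst    : ∀ {P Z} {hZ : is1Type Z} → Z → PE A P (C Z hZ)
  fm     : ∀ {Z Z'} {hZ : is1Type Z} {hZ' : is1Type Z'} → (Z → Z') → PE A (C Z hZ) (C Z' hZ')

ev : {A : Code} {X : Set} (c : ⟦ A ⟧ X → X) {S T : Code} → PE A S T → ⟦ S ⟧ X → ⟦ T ⟧ X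
ev c id x = x
ev c (e₁ · e₂) x = ev c e₂ (ev c e₁ x)
ev c constr x = c x
ev c inl x = inj₁ x
ev c inr x = inj₂ x
ev c pr₁ x = proj₁ x
ev c pr₂ x = proj₂ x
ev c ⟨ e₁ , e₂ ⟩ x = ev c e₁ x , ev c e₂ x
ev c (cst z) x = z
ev c (fm f) x = f x

natE : {A : Code} {X Y : Set} (cX : ⟦ A ⟧ X → X) (cY : ⟦ A ⟧ Y → Y) (f : X → Y)
       (fc : ∀ x → f (cX x) ≡ cY (fmap A f x)) {S T : Code} (e : PE A S T) (x : ⟦ S ⟧ X) →
       fmap T f (ev cX e x) ≡ ev cY e (fmap S f x)
natE cX cY f fc id x = refl
natE cX cY f fc (e₁ · e₂) x =
  trans (natE cX cY f fc e₂ (ev cX e₁ x)) (cong (ev cY e₂) (natE cX cY f fc e₁ x))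
natE cX cY f fc constr x = fc x
natE cX cY f fc inl x = refl
natE cX cY f fc inr x = refl
natE cX cY f fc pr₁ x = refl
natE cX cY f fc pr₂ x = refl
natE cX cY f fc ⟨ e₁ , e₂ ⟩ x = cong₂ _,_ (natE cX cY f fc e₁ x) (natE cX cY f fc e₂ x)
natE cX cY f fc (cst z) x = refl
natE cX cY f fc (fm g) x = refl

dev : {A : Code} {X : Set} {cX : ⟦ A ⟧ X → X} {Y : X → Set}
      (cY : (x : ⟦ A ⟧ X) → D⟦ A ⟧ Y x → Y (cX x)) {S T : Code} (e : PE A S T)
      (x : ⟦ S ⟧ X) → D⟦ S ⟧ Y x → D⟦ T ⟧ Y (ev cX e x)
dev cY id x y = y
dev cY (e₁ · e₂) x y = dev cY e₂ _ (dev cY e₁ x y)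
dev cY constr x y = cY x y
dev cY inl x y = y
dev cY inr x y = y
dev cY pr₁ x y = proj₁ y
dev cY pr₂ x y = proj₂ y
dev cY ⟨ e₁ , e₂ ⟩ x y = dev cY e₁ x y , dev cY e₂ x y
dev cY (cst z) x y = tt
dev cY (fm g) x y = tt

dnatE : {A : Code} {X : Set} {cX : ⟦ A ⟧ X → X} {Y : X → Set}
        (cY : (x : ⟦ A ⟧ X) → D⟦ A ⟧ Y x → Y (cX x)) (f : (x : X) → Y x)
        (fc : ∀ x → f (cX x) ≡ cY x (dfmap A f x)) {S T : Code} (e : PE A S T) (x : ⟦ S ⟧ X) →
        dfmap T f (ev cX e x) ≡ dev cY e x (dfmap S f x)
dnatE cY f fc id x = refl
dnatE cY f fc (e₁ · e₂) x =
  trans (dnatE cY f fc e₂ _) (cong (dev cY e₂ _) (dnatE cY f fc e₁ x))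
dnatE cY f fc constr x = fc x
dnatE cY f fc inl x = refl
dnatE cY f fc inr x = refl
dnatE cY f fc pr₁ x = refl
dnatE cY f fc pr₂ x = refl
dnatE cY f fc ⟨ e₁ , e₂ ⟩ x = cong₂ _,_ (dnatE cY f fc e₁ x) (dnatE cY f fc e₂ x)
dnatE cY f fc (cst z) x = refl
dnatE cY f fc (fm g) x = refl

data HE (A : Code) {J : Set} (Q : J → Code) (l r : (j : J) → PE A (Q j) I)
        {R T : Code} (a b : PE A R T) : {W : Code} → PE A R W → PE A R W → Set₁ where
  hrefl  : ∀ {W} (e : PE A R W) → HE A Q l r a b e e
  hinv   : ∀ {W} {e₁ e₂ : PE A R W} → HE A Q l r a b e₁ e₂ → HE A Q l r a b e₂ e₁
  hcomp  : ∀ {W} {e₁ e₂ e₃ : PE A R W} →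
           HE A Q l r a b e₁ e₂ → HE A Q l r a b e₂ e₃ → HE A Q l r a b e₁ e₃
  hap    : ∀ {W W'} {e₁ e₂ : PE A R W} (e : PE A W W') →
           HE A Q l r a b e₁ e₂ → HE A Q l r a b (e₁ · e) (e₂ · e)
  hassoc : ∀ {W₁ W₂ W} (e₁ : PE A R W₁) (e₂ : PE A W₁ W₂) (e₃ : PE A W₂ W) →
           HE A Q l r a b (e₁ · (e₂ · e₃)) ((e₁ · e₂) · e₃)
  hlunit : ∀ {W} (e : PE A R W) → HE A Q l r a b (id · e) e
  hrunit : ∀ {W} (e : PE A R W) → HE A Q l r a b (e · id) e
  hpr₁   : ∀ {W₁ W₂} (e₁ : PE A R W₁) (e₂ : PE A R W₂) → HE A Q l r a b (⟨ e₁ , e₂ ⟩ · pr₁) e₁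
  hpr₂   : ∀ {W₁ W₂} (e₁ : PE A R W₁) (e₂ : PE A R W₂) → HE A Q l r a b (⟨ e₁ , e₂ ⟩ · pr₂) e₂
  hpair  : ∀ {W₁ W₂} {e₁ e₂ : PE A R W₁} {e₃ e₄ : PE A R W₂} →
           HE A Q l r a b e₁ e₂ → HE A Q l r a b e₃ e₄ → HE A Q l r a b ⟨ e₁ , e₃ ⟩ ⟨ e₂ , e₄ ⟩
  hcpair : ∀ {W₁ W₂ W₃} (e₁ : PE A R W₁) (e₂ : PE A W₁ W₂) (e₃ : PE A W₁ W₃) →
           HE A Q l r a b (e₁ · ⟨ e₂ , e₃ ⟩) ⟨ e₁ · e₂ , e₁ · e₃ ⟩
  hcst   : ∀ {W Z} {hZ : is1Type Z} (e : PE A R W) (z : Z) →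
           HE A Q l r a b (e · cst {hZ = hZ} z) (cst z)
  hpath  : (j : J) (e : PE A R (Q j)) → HE A Q l r a b (e · l j) (e · r j)
  harg   : HE A Q l r a b a b

evH : {A : Code} {J : Set} {Q : J → Code} {l r : (j : J) → PE A (Q j) I}
      {R T : Code} {a b : PE A R T} {X : Set} (c : ⟦ A ⟧ X → X)
      (p : (j : J) (x : ⟦ Q j ⟧ X) → ev c (l j) x ≡ ev c (r j) x)
      {W : Code} {s t : PE A R W} → HE A Q l r a b s t →
      (x : ⟦ R ⟧ X) → ev c a x ≡ ev c b x → ev c s x ≡ ev c t x
evH c p (hrefl e) x w = refl
evH c p (hinv h) x w = sym (evH c p h x w)
evH c p (hcomp h₁ h₂) x w = trans (evH c p h₁ x w) (evH c p h₂ x w)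
evH c p (hap e h) x w = cong (ev c e) (evH c p h x w)
evH c p (hassoc e₁ e₂ e₃) x w = refl
evH c p (hlunit e) x w = refl
evH c p (hrunit e) x w = refl
evH c p (hpr₁ e₁ e₂) x w = refl
evH c p (hpr₂ e₁ e₂) x w = refl
evH c p (hpair h₁ h₂) x w = cong₂ _,_ (evH c p h₁ x w) (evH c p h₂ x w)
evH c p (hcpair e₁ e₂ e₃) x w = refl
evH c p (hcst e z) x w = refl
evH c p (hpath j e) x w = p j (ev c e x)
evH c p harg x w = w

devH : {A : Code} {J : Set} {Q : J → Code} {l r : (j : J) → PE A (Q j) I}
       {R T : Code} {a b : PE A R T} {X : Set} {c : ⟦ A ⟧ X → X}
       {p : (j : J) (x : ⟦ Q j ⟧ X) → ev c (l j) x ≡ ev c (r j) x}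
       {Y : X → Set} (cY : (x : ⟦ A ⟧ X) → D⟦ A ⟧ Y x → Y (c x))
       (pY : (j : J) (x : ⟦ Q j ⟧ X) (y : D⟦ Q j ⟧ Y x) →
             PathOver Y (p j x) (dev cY (l j) x y) (dev cY (r j) x y))
       {W : Code} {s t : PE A R W} (h : HE A Q l r a b s t)
       (x : ⟦ R ⟧ X) (y : D⟦ R ⟧ Y x) (w : ev c a x ≡ ev c b x)
       (wb : PathOver (D⟦ T ⟧ Y) w (dev cY a x y) (dev cY b x y)) →
       PathOver (D⟦ W ⟧ Y) (evH c p h x w) (dev cY s x y) (dev cY t x y)
devH cY pY (hrefl e) x y w wb = refl
devH cY pY (hinv h) x y w wb = dsym (devH cY pY h x y w wb)
devH cY pY (hcomp h₁ h₂) x y w wb = dtrans (devH cY pY h₁ x y w wb) (devH cY pY h₂ x y w wb)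
devH {c = c} cY pY (hap e h) x y w wb = dap (ev c e) (dev cY e) (devH cY pY h x y w wb)
devH cY pY (hassoc e₁ e₂ e₃) x y w wb = refl
devH cY pY (hlunit e) x y w wb = refl
devH cY pY (hrunit e) x y w wb = refl
devH cY pY (hpr₁ e₁ e₂) x y w wb = refl
devH cY pY (hpr₂ e₁ e₂) x y w wb = refl
devH cY pY (hpair h₁ h₂) x y w wb = dpair (devH cY pY h₁ x y w wb) (devH cY pY h₂ x y w wb)
devH cY pY (hcpair e₁ e₂ e₃) x y w wb = refl
devH cY pY (hcst e z) x y w wb = refl
devH {c = c} cY pY (hpath j e) x y w wb = pY j (ev c e x) (dev cY e x y)
devH cY pY harg x y w wb = wb

record Signature : Set₁ where
  field
    A : Code
    J : Set
    Q : J → Code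
    l r : (j : J) → PE A (Q j) I
    K : Set
    R T : K → Code
    a b : (k : K) → PE A (R k) (T k)
    s t : (k : K) → PE A (R k) I
    h h' : (k : K) → HE A Q l r (a k) (b k) (s k) (t k)

module _ (Σs : Signature) where
  open Signature Σs

  record Alg : Set₁ where
    field
      car   : Set
      trunc : is1Type car
      c     : ⟦ A ⟧ car → car
      p     : (j : J) (x : ⟦ Q j ⟧ car) → ev c (l j) x ≡ ev c (r j) x
      heq   : (k : K) (x : ⟦ R k ⟧ car) (w : ev c (a k) x ≡ ev c (b k) x) →
              evH c p (h k) x w ≡ evH c p (h' k) x w
  open Alg public

  record Cell1 (X Y : Alg) : Set where
    field
      fun : car X → car Y
      fc  : ∀ x → fun (c X x) ≡ c Y (fmap A fun x)
      fp  : ∀ j (x : ⟦ Q j ⟧ (car X)) →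
            trans (cong fun (p X j x)) (natE (c X) (c Y) fun fc (r j) x)
            ≡ trans (natE (c X) (c Y) fun fc (l j) x) (p Y j (fmap (Q j) fun x))
  open Cell1 public

  record Cell2 {X Y : Alg} (f g : Cell1 X Y) : Set where
    field
      θ  : ∀ x → fun f x ≡ fun g x
      θc : ∀ x → trans (θ (c X x)) (fc g x) ≡ trans (fc f x) (cong (c Y) (fmapH A θ x))
  open Cell2 public

  isBiinitial : Alg → Set₁
  isBiinitial X =
    ((Y : Alg) → Cell1 X Y)
    × ((Y : Alg) (f g : Cell1 X Y) → Cell2 f g)
    × ((Y : Alg) (f g : Cell1 X Y) (α β : Cell2 f g) → α ≡ β)

  record DispAlg (X : Alg) : Set₁ where
    field
      Fam   : car X → Set
      dtrunc : ∀ x → is1Type (Fam x)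
      dc    : (x : ⟦ A ⟧ (car X)) → D⟦ A ⟧ Fam x → Fam (c X x)
      dp    : (j : J) (x : ⟦ Q j ⟧ (car X)) (y : D⟦ Q j ⟧ Fam x) →
              PathOver Fam (p X j x) (dev dc (l j) x y) (dev dc (r j) x y)
      dheq  : (k : K) (x : ⟦ R k ⟧ (car X)) (y : D⟦ R k ⟧ Fam x)
              (w : ev (c X) (a k) x ≡ ev (c X) (b k) x)
              (wb : PathOver (D⟦ T k ⟧ Fam) w (dev dc (a k) x y) (dev dc (b k) x y)) →
              GlobeOver Fam (heq X k x w)
                (devH dc dp (h k) x y w wb) (devH dc dp (h' k) x y w wb)
  open DispAlg public

  record Section {X : Alg} (D : DispAlg X) : Set where
    field
      sec  : (x : car X) → Fam D x
      secc : ∀ x → sec (c X x) ≡ dc D x (dfmap A sec x)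
      secp : ∀ j (x : ⟦ Q j ⟧ (car X)) →
             SquareOver (Fam D) (refl {x = p X j x})
               (dnatE (dc D) sec secc (l j) x) (dnatE (dc D) sec secc (r j) x)
               (apd sec (p X j x)) (dp D j x (dfmap (Q j) sec x))
  open Section public

  isHIT : Alg → Set₁
  isHIT X = (D : DispAlg X) → Section D

{-# OPTIONS --without-K #-}
module Submission where

-- If X is a HIT, 1-cells, 2-cells and equalities of 2-cells out of X are sections of three
-- displayed algebras over X: the constant family Y, the family x ↦ f x ≡ g x of paths between
-- two 1-cells, and the family x ↦ θ x ≡ θ' x of 2-paths between two 2-cells.  The last two
-- have set-, resp. proposition-valued fibres, so their higher coherences hold automatically.
-- Conversely, if X is biinitial, a displayed algebra D over X has a total algebra Σ X D with a
-- projection to X; a 1-cell u : X → Σ X D followed by the projection admits a 2-cell to the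
-- identity of X, and transporting u along it turns the second component of u into a section.

open import Defs
open import Function using (_⇔_; _∘_)
open import Function.Bundles using (mk⇔)
open import Level using () renaming (zero to lzero)
open import Data.Unit using (tt)
open import Data.Product using (Σ; _×_; _,_; proj₁; proj₂)
open import Data.Sum using (inj₁; inj₂)
open import Relation.Binary.PropositionalEquality
  using (_≡_; refl; sym; trans; cong; cong₂; subst)
open import Relation.Binary.PropositionalEquality.Properties
  using (trans-reflʳ; trans-symˡ; trans-symʳ; trans-injectiveˡ; cong-id; cong-∘; sym-cong; trans-cong)

infixr 30 _∙_
_∙_ : ∀ {ℓ} {A : Set ℓ} {x y z : A} → x ≡ y → y ≡ z → x ≡ z
_∙_ = trans

module _ {ℓ ℓ'} {A : Set ℓ} {B : Set ℓ'} where

  cong-∙ : (f : A → B) {x y z : A} (p : x ≡ y) (q : y ≡ z) → cong f (p ∙ q) ≡ cong f p ∙ cong f q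
  cong-∙ f p q = sym (trans-cong p)

  cong-sym : (f : A → B) {x y : A} (p : x ≡ y) → cong f (sym p) ≡ sym (cong f p)
  cong-sym f p = sym (sym-cong p)

  cong-const : {b : B} {x y : A} (p : x ≡ y) → cong (λ _ → b) p ≡ refl
  cong-const refl = refl

  cong-proj₁-cong₂ : {x y : A} {u v : B} (p : x ≡ y) (q : u ≡ v) → cong proj₁ (cong₂ _,_ p q) ≡ p
  cong-proj₁-cong₂ refl refl = refl

  cong-proj₂-cong₂ : {x y : A} {u v : B} (p : x ≡ y) (q : u ≡ v) → cong proj₂ (cong₂ _,_ p q) ≡ q
  cong-proj₂-cong₂ refl refl = refl

cong-pairing : ∀ {ℓ ℓ' ℓ'' ℓ'''} {A : Set ℓ} {B : Set ℓ'} {C : Set ℓ''} {D : Set ℓ'''}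
               (k : B → C → D) (f : A → B) (g : A → C) {x y : A} (q : x ≡ y) →
               cong (λ z → k (f z) (g z)) q ≡ cong₂ k (cong f q) (cong g q)
cong-pairing k f g refl = refl

module _ {ℓ} {A : Set ℓ} where

  conj-refl : {x y : A} (d d' : x ≡ y) → d ≡ d' → refl ≡ d ∙ refl ∙ sym d'
  conj-refl d .d refl = sym (trans-symʳ d)

  sym-conj : {x y z w : A} (a : x ≡ y) (b : y ≡ z) (d : w ≡ z) → sym (a ∙ b ∙ sym d) ≡ d ∙ sym b ∙ sym a
  sym-conj refl refl refl = refl

  conj-∙ : {x y z w u v : A} (a : x ≡ y) (b : y ≡ z) (m : w ≡ z) (b' : z ≡ u) (d : v ≡ u) →
           (a ∙ b ∙ sym m) ∙ (m ∙ b' ∙ sym d) ≡ a ∙ (b ∙ b') ∙ sym d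
  conj-∙ refl refl refl refl refl = refl

  conj-unconj : {x y z w : A} (a : x ≡ y) (o : x ≡ z) (d : z ≡ w) → o ≡ a ∙ (sym a ∙ o ∙ d) ∙ sym d
  conj-unconj refl refl refl = refl

  conj-∙-sym : {x y z w : A} (a : x ≡ y) (b : y ≡ z) (d : w ≡ z) → (a ∙ b ∙ sym d) ∙ d ≡ a ∙ b
  conj-∙-sym refl refl refl = refl

module _ {ℓ ℓ'} {A : Set ℓ} {B : Set ℓ'} where

  cong-conj : (f : A → B) {x₁ x₂ x₃ x₄ : A} {y₁ y₄ : B}
              (a : y₁ ≡ f x₁) (b : x₁ ≡ x₂) (e : x₂ ≡ x₃) (d : x₄ ≡ x₃) (a' : y₄ ≡ f x₄) →
              a ∙ cong f (b ∙ e ∙ sym d) ∙ sym a' ≡ (a ∙ cong f b) ∙ cong f e ∙ sym (a' ∙ cong f d)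
  cong-conj f refl refl refl refl refl = refl

  conj-homotopy : (F G : A → B) (H : ∀ z → F z ≡ G z) {z₁ z₂ : A} {u v : B}
                  (a : u ≡ F z₁) (b : v ≡ G z₁) (d : z₁ ≡ z₂) →
                  a ∙ H z₁ ∙ sym b ≡ (a ∙ cong F d) ∙ H z₂ ∙ sym (b ∙ cong G d)
  conj-homotopy F G H refl refl refl = refl

∙-cong-∘ : ∀ {ℓ ℓ' ℓ''} {A : Set ℓ} {A' : Set ℓ'} {B : Set ℓ''} (f : A → A') (g : A' → B) {y : B} {u : A'} {z z' : A}
           (a : y ≡ g u) (b : u ≡ f z) (q : z ≡ z') →
           (a ∙ cong g b) ∙ cong (g ∘ f) q ≡ a ∙ cong g (b ∙ cong f q)
∙-cong-∘ f g refl refl refl = refl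

cong₂-conj : ∀ {ℓ ℓ' ℓ''} {A : Set ℓ} {B : Set ℓ'} {C : Set ℓ''} (k : A → B → C)
             {x₁ y₁ z₁ w₁ : A} {x₂ y₂ z₂ w₂ : B}
             (a₁ : x₁ ≡ y₁) (b₁ : y₁ ≡ z₁) (d₁ : w₁ ≡ z₁) (a₂ : x₂ ≡ y₂) (b₂ : y₂ ≡ z₂) (d₂ : w₂ ≡ z₂) →
             cong₂ k (a₁ ∙ b₁ ∙ sym d₁) (a₂ ∙ b₂ ∙ sym d₂) ≡ cong₂ k a₁ a₂ ∙ cong₂ k b₁ b₂ ∙ sym (cong₂ k d₁ d₂)
cong₂-conj k refl refl refl refl refl refl = refl

cong₂-∙-cong : ∀ {ℓ ℓ' ℓ'' ℓ'''} {A : Set ℓ} {B : Set ℓ'} {C : Set ℓ''} {D : Set ℓ'''}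
               (k : B → C → D) (f : A → B) (g : A → C) {u : B} {v : C} {z z' : A}
               (a : u ≡ f z) (b : v ≡ g z) (q : z ≡ z') →
               cong₂ k a b ∙ cong (λ w → k (f w) (g w)) q ≡ cong₂ k (a ∙ cong f q) (b ∙ cong g q)
cong₂-∙-cong k f g refl refl refl = refl

isProp→isSet : ∀ {ℓ} {A : Set ℓ} → isProp A → isSet A
isProp→isSet {A = A} pr a b p q = canonical p ∙ sym (canonical q)
  where
    canonical : {x y : A} (p : x ≡ y) → p ≡ sym (pr a x) ∙ pr a y
    canonical {x} refl = sym (trans-symˡ (pr a x))

isSet→is1Type : ∀ {ℓ} {A : Set ℓ} → isSet A → is1Type A
isSet→is1Type st a b = isProp→isSet (st a b)

isContr→isProp : ∀ {ℓ} {A : Set ℓ} → isContr A → isProp A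
isContr→isProp (c , h) a b = sym (h a) ∙ h b

isProp→PathOver : {T : Set} (B : T → Set) → (∀ t → isProp (B t)) →
                  {t₁ t₂ : T} (p : t₁ ≡ t₂) (b₁ : B t₁) (b₂ : B t₂) → PathOver B p b₁ b₂
isProp→PathOver B pr refl b₁ b₂ = pr _ b₁ b₂

isPropPathOver : {T : Set} (B : T → Set) → (∀ t → isSet (B t)) →
                 {t₁ t₂ : T} (p : t₁ ≡ t₂) (b₁ : B t₁) (b₂ : B t₂) → isProp (PathOver B p b₁ b₂)
isPropPathOver B st refl b₁ b₂ = st _ b₁ b₂

isSetPathOver : {T : Set} (B : T → Set) → (∀ t → is1Type (B t)) →
                {t₁ t₂ : T} (p : t₁ ≡ t₂) (b₁ : B t₁) (b₂ : B t₂) → isSet (PathOver B p b₁ b₂)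
isSetPathOver B tr refl b₁ b₂ = tr _ b₁ b₂

isSet→GlobeOver : {T : Set} (B : T → Set) → (∀ t → isSet (B t)) →
                  {t₁ t₂ : T} {p q : t₁ ≡ t₂} (g : p ≡ q) {b₁ : B t₁} {b₂ : B t₂}
                  (pb : PathOver B p b₁ b₂) (qb : PathOver B q b₁ b₂) → GlobeOver B g pb qb
isSet→GlobeOver B st {p = p} refl pb qb = isPropPathOver B st p _ _ pb qb

module _ {ℓ ℓ'} {A : Set ℓ} {B : Set ℓ'} (r : B → A) (s : A → B) (rs : ∀ a → r (s a) ≡ a) where

  isPropRetract : isProp B → isProp A
  isPropRetract pB a a' = sym (rs a) ∙ cong r (pB (s a) (s a')) ∙ rs a'

  retract-≡ : (a a' : A) (q : a ≡ a') → sym (rs a) ∙ cong r (cong s q) ∙ rs a' ≡ q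
  retract-≡ a .a refl = trans-symˡ (rs a)

isSetRetract : ∀ {ℓ ℓ'} {A : Set ℓ} {B : Set ℓ'} (r : B → A) (s : A → B) → (∀ a → r (s a) ≡ a) → isSet B → isSet A
isSetRetract r s rs sB a a' =
  isPropRetract (λ q → sym (rs a) ∙ cong r q ∙ rs a') (cong s) (retract-≡ r s rs a a') (sB (s a) (s a'))

module _ {T : Set} {F : T → Set} where

  ΣPath : {t₁ t₂ : T} {b₁ : F t₁} {b₂ : F t₂} (q : t₁ ≡ t₂) →
          PathOver F q b₁ b₂ → _≡_ {A = Σ T F} (t₁ , b₁) (t₂ , b₂)
  ΣPath {t₁ = t} refl o = cong (t ,_) o

  unΣPath : {u v : Σ T F} (r : u ≡ v) → PathOver F (cong proj₁ r) (proj₂ u) (proj₂ v)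
  unΣPath refl = refl

  ΣPath-unΣPath : {u v : Σ T F} (r : u ≡ v) → ΣPath (cong proj₁ r) (unΣPath r) ≡ r
  ΣPath-unΣPath refl = refl

  cong-proj₁-ΣPath : {t₁ t₂ : T} {b₁ : F t₁} {b₂ : F t₂} (q : t₁ ≡ t₂) (o : PathOver F q b₁ b₂) →
                     cong proj₁ (ΣPath q o) ≡ q
  cong-proj₁-ΣPath refl refl = refl

  ΣPath-dsym : {t₁ t₂ : T} {b₁ : F t₁} {b₂ : F t₂} (q : t₁ ≡ t₂) (o : PathOver F q b₁ b₂) →
               ΣPath (sym q) (dsym {B = F} {p = q} o) ≡ sym (ΣPath q o)
  ΣPath-dsym refl refl = refl

  ΣPath-dtrans : {t₁ t₂ t₃ : T} {b₁ : F t₁} {b₂ : F t₂} {b₃ : F t₃}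
                 (q : t₁ ≡ t₂) (q' : t₂ ≡ t₃) (o : PathOver F q b₁ b₂) (o' : PathOver F q' b₂ b₃) →
                 ΣPath (q ∙ q') (dtrans {B = F} {p = q} {q = q'} o o') ≡ ΣPath q o ∙ ΣPath q' o'
  ΣPath-dtrans refl refl refl refl = refl

  ΣPath-GlobeOver : {t₁ t₂ : T} {q q' : t₁ ≡ t₂} (g : q ≡ q') {b₁ : F t₁} {b₂ : F t₂}
                    (o : PathOver F q b₁ b₂) (o' : PathOver F q' b₁ b₂) → GlobeOver F g o o' →
                    ΣPath q o ≡ ΣPath q' o'
  ΣPath-GlobeOver {q = q} refl o o' gl = cong (ΣPath q) gl

isPropΣ : {T : Set} {F : T → Set} → isProp T → (∀ t → isProp (F t)) → isProp (Σ T F)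
isPropΣ {F = F} pT pF (t₁ , b₁) (t₂ , b₂) = ΣPath (pT t₁ t₂) (isProp→PathOver F pF (pT t₁ t₂) b₁ b₂)

module _ {T : Set} {F : T → Set} (u v : Σ T F) where

  ΣPaths→≡ : (Σ (proj₁ u ≡ proj₁ v) λ q → PathOver F q (proj₂ u) (proj₂ v)) → u ≡ v
  ΣPaths→≡ (q , o) = ΣPath q o

  ≡→ΣPaths : u ≡ v → Σ (proj₁ u ≡ proj₁ v) λ q → PathOver F q (proj₂ u) (proj₂ v)
  ≡→ΣPaths r = cong proj₁ r , unΣPath r

isSetΣ : {T : Set} {F : T → Set} → isSet T → (∀ t → isSet (F t)) → isSet (Σ T F)
isSetΣ {F = F} sT sF u v = isPropRetract (ΣPaths→≡ u v) (≡→ΣPaths u v) ΣPath-unΣPath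
  (isPropΣ (sT (proj₁ u) (proj₁ v)) (λ q → isPropPathOver F sF q (proj₂ u) (proj₂ v)))

is1TypeΣ : {T : Set} {F : T → Set} → is1Type T → (∀ t → is1Type (F t)) → is1Type (Σ T F)
is1TypeΣ {F = F} tT tF u v = isSetRetract (ΣPaths→≡ u v) (≡→ΣPaths u v) ΣPath-unΣPath
  (isSetΣ (tT (proj₁ u) (proj₁ v)) (λ q → isSetPathOver F tF q (proj₂ u) (proj₂ v)))

ΣPath-dap : {T T' : Set} {F : T → Set} {F' : T' → Set} (g₁ : T → T') (g₂ : (t : T) → F t → F' (g₁ t))
            {t₁ t₂ : T} {b₁ : F t₁} {b₂ : F t₂} (q : t₁ ≡ t₂) (o : PathOver F q b₁ b₂) →
            ΣPath (cong g₁ q) (dap {B = F} {B' = F'} g₁ g₂ {p = q} o)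
            ≡ cong (λ w → g₁ (proj₁ w) , g₂ (proj₁ w) (proj₂ w)) (ΣPath q o)
ΣPath-dap g₁ g₂ refl refl = refl

regroup : {T₁ T₂ : Set} {F₁ : T₁ → Set} {F₂ : T₂ → Set} → Σ T₁ F₁ → Σ T₂ F₂ →
          Σ (T₁ × T₂) (λ x → F₁ (proj₁ x) × F₂ (proj₂ x))
regroup u v = (proj₁ u , proj₁ v) , (proj₂ u , proj₂ v)

ΣPath-dpair : {T₁ T₂ : Set} {F₁ : T₁ → Set} {F₂ : T₂ → Set} {s₁ s₂ : T₁} {t₁ t₂ : T₂}
              {b₁ : F₁ s₁} {b₂ : F₁ s₂} {d₁ : F₂ t₁} {d₂ : F₂ t₂}
              (q : s₁ ≡ s₂) (q' : t₁ ≡ t₂) (o : PathOver F₁ q b₁ b₂) (o' : PathOver F₂ q' d₁ d₂) →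
              ΣPath (cong₂ _,_ q q') (dpair {B₁ = F₁} {B₂ = F₂} {p = q} {q = q'} o o')
              ≡ cong₂ regroup (ΣPath {F = F₁} q o) (ΣPath {F = F₂} q' o')
ΣPath-dpair refl refl refl refl = refl

module FibrePaths {T : Set} (F : T → Set) (tT : is1Type T) {t : T} {y₁ y₂ : F t} where

  fibrePath : (r : _≡_ {A = Σ T F} (t , y₁) (t , y₂)) → cong proj₁ r ≡ refl → y₁ ≡ y₂
  fibrePath r e = subst (λ q → PathOver F q y₁ y₂) e (unΣPath r)

  cong-pair-fibrePath : (r : _≡_ {A = Σ T F} (t , y₁) (t , y₂)) (e : cong proj₁ r ≡ refl) →
                        cong (t ,_) (fibrePath r e) ≡ r
  cong-pair-fibrePath r e = cong-pair-subst (cong proj₁ r) (unΣPath r) e ∙ ΣPath-unΣPath r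
    where
      cong-pair-subst : (q : t ≡ t) (o : PathOver F q y₁ y₂) (e : q ≡ refl) →
              cong (t ,_) (subst (λ q → PathOver F q y₁ y₂) e o) ≡ ΣPath q o
      cong-pair-subst q o refl = refl

  cong-pair-injective : (o o' : y₁ ≡ y₂) → cong (_,_ {B = F} t) o ≡ cong (t ,_) o' → o ≡ o'
  cong-pair-injective o o' H =
    sym (fibrePath-cong o (over-refl o)) ∙ fibrePath-resp H (over-refl o) (over-refl o') ∙ fibrePath-cong o' (over-refl o')
    where
      over-refl : (o : y₁ ≡ y₂) → cong proj₁ (cong (_,_ {B = F} t) o) ≡ refl
      over-refl refl = refl

      fibrePath-cong : (o : y₁ ≡ y₂) (e : cong proj₁ (cong (_,_ {B = F} t) o) ≡ refl) → fibrePath (cong (t ,_) o) e ≡ o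
      fibrePath-cong refl e = cong (λ e' → subst (λ q → PathOver F q y₁ y₁) e' refl) (tT t t refl refl e refl)

      fibrePath-resp : {r r' : _≡_ {A = Σ T F} (t , y₁) (t , y₂)} → r ≡ r' →
                       (e : cong proj₁ r ≡ refl) (e' : cong proj₁ r' ≡ refl) → fibrePath r e ≡ fibrePath r' e'
      fibrePath-resp {r} refl e e' = cong (fibrePath r) (tT t t (cong proj₁ r) refl e e')

module FunExt (ua : Univalence lzero) where

  postcomp-isEquiv : {A B : Set} (X : Set) (e : A ≃ B) → isEquiv (λ (g : X → A) → proj₁ e ∘ g)
  postcomp-isEquiv {A} X e =
    subst (λ e' → isEquiv (λ (g : X → A) → proj₁ e' ∘ g)) (proj₂ (proj₁ (ua A _ e))) (along (proj₁ (proj₁ (ua A _ e))))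
    where
      along : {B' : Set} (p : A ≡ B') → isEquiv (λ (g : X → A) → proj₁ (idtoeqv p) ∘ g)
      along refl y = (y , refl) , λ { (x , refl) → refl }

  -- Π P is a retract of the fibre over the identity of postcomposition with proj₁ : Σ X P → X.
  weakFunExt : {X : Set} (P : X → Set) → (∀ x → isContr (P x)) → isContr ((x : X) → P x)
  weakFunExt {X} P pc = fill (proj₁ centre) , λ f → cong fill (proj₂ centre (unfill f))
    where
      proj₁-isEquiv : isEquiv {A = Σ X P} proj₁
      proj₁-isEquiv x = ((x , proj₁ (pc x)) , refl) , λ { ((.x , y) , refl) → cong (λ z → (x , z) , refl) (proj₂ (pc x) y) }
      Fib : Set
      Fib = fiber (λ (g : X → Σ X P) → proj₁ ∘ g) (λ x → x)
      centre : isContr Fib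
      centre = postcomp-isEquiv X (proj₁ , proj₁-isEquiv) (λ x → x)
      fill : Fib → (x : X) → P x
      fill (g , q) x = subst P (cong (λ k → k x) q) (proj₂ (g x))
      unfill : ((x : X) → P x) → Fib
      unfill f = (λ x → x , f x) , refl

  htpyInd : {X : Set} {P : X → Set} {g : (x : X) → P x}
            (Q : (f : (x : X) → P x) → (∀ x → f x ≡ g x) → Set) →
            Q g (λ _ → refl) → ∀ f H → Q f H
  htpyInd {X} {P} {g} Q q f H =
    subst (λ k → Q (λ x → proj₁ (k x)) (λ x → proj₂ (k x)))
      (isContr→isProp (weakFunExt (λ x → Σ (P x) λ y → y ≡ g x) (λ x → singleton (g x)))
                      (λ x → g x , refl) (λ x → f x , H x))
      q
    where
      singleton : {A : Set} (a : A) → isContr (Σ A λ b → b ≡ a)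
      singleton a = (a , refl) , λ { (b , refl) → refl }

  funExt : {X : Set} {P : X → Set} {f g : (x : X) → P x} → (∀ x → f x ≡ g x) → f ≡ g
  funExt {g = g} H = htpyInd (λ f _ → f ≡ g) refl _ H

  isPropΠ : {X : Set} {P : X → Set} → (∀ x → isProp (P x)) → isProp ((x : X) → P x)
  isPropΠ pr f g = funExt (λ x → pr x (f x) (g x))

fmap-id : (P : Code) {X : Set} (x : ⟦ P ⟧ X) → fmap P (λ x → x) x ≡ x
fmap-id (C Z _) x = refl
fmap-id I x = refl
fmap-id (P ⊕ P') (inj₁ x) = cong inj₁ (fmap-id P x)
fmap-id (P ⊕ P') (inj₂ x) = cong inj₂ (fmap-id P' x)
fmap-id (P ⊗ P') x = cong₂ _,_ (fmap-id P (proj₁ x)) (fmap-id P' (proj₂ x))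

fmap-∘ : (P : Code) {X Y Z : Set} (f : X → Y) (g : Y → Z) (x : ⟦ P ⟧ X) →
         fmap P g (fmap P f x) ≡ fmap P (g ∘ f) x
fmap-∘ (C Z _) f g x = refl
fmap-∘ I f g x = refl
fmap-∘ (P ⊕ P') f g (inj₁ x) = cong inj₁ (fmap-∘ P f g x)
fmap-∘ (P ⊕ P') f g (inj₂ x) = cong inj₂ (fmap-∘ P' f g x)
fmap-∘ (P ⊗ P') f g x = cong₂ _,_ (fmap-∘ P f g (proj₁ x)) (fmap-∘ P' f g (proj₂ x))

fmapH-refl : (P : Code) {X Y : Set} {f : X → Y} (x : ⟦ P ⟧ X) → fmapH P {f = f} (λ _ → refl) x ≡ refl
fmapH-refl (C Z _) x = refl
fmapH-refl I x = refl
fmapH-refl (P ⊕ P') (inj₁ x) = cong (cong inj₁) (fmapH-refl P x)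
fmapH-refl (P ⊕ P') (inj₂ x) = cong (cong inj₂) (fmapH-refl P' x)
fmapH-refl (P ⊗ P') x = cong₂ (cong₂ _,_) (fmapH-refl P (proj₁ x)) (fmapH-refl P' (proj₂ x))

fromConstD : (P : Code) {X B : Set} (x : ⟦ P ⟧ X) → D⟦ P ⟧ (λ _ → B) x → ⟦ P ⟧ B
fromConstD (C Z _) z _ = z
fromConstD I x y = y
fromConstD (P ⊕ P') (inj₁ x) y = inj₁ (fromConstD P x y)
fromConstD (P ⊕ P') (inj₂ x) y = inj₂ (fromConstD P' x y)
fromConstD (P ⊗ P') x y = fromConstD P (proj₁ x) (proj₁ y) , fromConstD P' (proj₂ x) (proj₂ y)

fromConstD-dfmap : (P : Code) {X B : Set} (f : X → B) (x : ⟦ P ⟧ X) →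
                   fromConstD P x (dfmap P {Y = λ _ → B} f x) ≡ fmap P f x
fromConstD-dfmap (C Z _) f x = refl
fromConstD-dfmap I f x = refl
fromConstD-dfmap (P ⊕ P') f (inj₁ x) = cong inj₁ (fromConstD-dfmap P f x)
fromConstD-dfmap (P ⊕ P') f (inj₂ x) = cong inj₂ (fromConstD-dfmap P' f x)
fromConstD-dfmap (P ⊗ P') f x = cong₂ _,_ (fromConstD-dfmap P f (proj₁ x)) (fromConstD-dfmap P' f (proj₂ x))

module _ {X B : Set} {f g : X → B} where

  fromPathD : (P : Code) (x : ⟦ P ⟧ X) → D⟦ P ⟧ (λ x → f x ≡ g x) x → fmap P f x ≡ fmap P g x
  fromPathD (C Z _) z _ = refl
  fromPathD I x y = y
  fromPathD (P ⊕ P') (inj₁ x) y = cong inj₁ (fromPathD P x y)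
  fromPathD (P ⊕ P') (inj₂ x) y = cong inj₂ (fromPathD P' x y)
  fromPathD (P ⊗ P') x y = cong₂ _,_ (fromPathD P (proj₁ x) (proj₁ y)) (fromPathD P' (proj₂ x) (proj₂ y))

  fromPathD-dfmap : (θ : ∀ x → f x ≡ g x) (P : Code) (x : ⟦ P ⟧ X) →
                    fromPathD P x (dfmap P {Y = λ x → f x ≡ g x} θ x) ≡ fmapH P θ x
  fromPathD-dfmap θ (C Z _) x = refl
  fromPathD-dfmap θ I x = refl
  fromPathD-dfmap θ (P ⊕ P') (inj₁ x) = cong (cong inj₁) (fromPathD-dfmap θ P x)
  fromPathD-dfmap θ (P ⊕ P') (inj₂ x) = cong (cong inj₂) (fromPathD-dfmap θ P' x)
  fromPathD-dfmap θ (P ⊗ P') x = cong₂ (cong₂ _,_) (fromPathD-dfmap θ P (proj₁ x)) (fromPathD-dfmap θ P' (proj₂ x))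

  fromPath²D : {θ θ' : ∀ x → f x ≡ g x} (P : Code) (x : ⟦ P ⟧ X) →
               D⟦ P ⟧ (λ x → θ x ≡ θ' x) x → fmapH P θ x ≡ fmapH P θ' x
  fromPath²D (C Z _) z _ = refl
  fromPath²D I x y = y
  fromPath²D (P ⊕ P') (inj₁ x) y = cong (cong inj₁) (fromPath²D P x y)
  fromPath²D (P ⊕ P') (inj₂ x) y = cong (cong inj₂) (fromPath²D P' x y)
  fromPath²D (P ⊗ P') x y = cong₂ (cong₂ _,_) (fromPath²D P (proj₁ x) (proj₁ y)) (fromPath²D P' (proj₂ x) (proj₂ y))

-- The cases of the inductions computing naturality paths in the factored form
-- sym L ∙ cong ψ n ∙ D ∙ cong g L'.
module FactoredNaturality where

  id-case : ∀ {ℓ} {A : Set ℓ} {x y : A} (a : x ≡ y) → refl ≡ sym a ∙ refl ∙ refl ∙ cong (λ z → z) a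
  id-case refl = refl

  inj-case : ∀ {ℓ ℓ'} {A : Set ℓ} {B : Set ℓ'} (f : A → B) {x y : A} (a : x ≡ y) →
             refl ≡ sym (cong f a) ∙ refl ∙ refl ∙ cong f a
  inj-case f refl = refl

  pr₁-case : ∀ {ℓ ℓ'} {A : Set ℓ} {B : Set ℓ'} {x y : A} {u v : B} (a : x ≡ y) (b : u ≡ v) →
             refl ≡ sym a ∙ refl ∙ refl ∙ cong proj₁ (cong₂ _,_ a b)
  pr₁-case refl refl = refl

  pr₂-case : ∀ {ℓ ℓ'} {A : Set ℓ} {B : Set ℓ'} {x y : A} {u v : B} (a : x ≡ y) (b : u ≡ v) →
             refl ≡ sym b ∙ refl ∙ refl ∙ cong proj₂ (cong₂ _,_ a b)
  pr₂-case refl refl = refl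

  ·-case : ∀ {ℓ₁ ℓ₂ ℓ₃ ℓ₄} {U : Set ℓ₁} {V : Set ℓ₂} {B : Set ℓ₃} {B' : Set ℓ₄}
           (ψ : B' → U) (d : B → B') (ψ' : B → V) (g : V → U) (D : ∀ y → ψ (d y) ≡ g (ψ' y))
           {s₀ : B'} {n₀ : U} {y₀ y₁ : B} {n₁ v₀ v₁ : V}
           (L : ψ s₀ ≡ n₀) (n : s₀ ≡ d y₀) (L₁ : ψ' y₀ ≡ n₁) (n' : y₀ ≡ y₁) (D' : ψ' y₁ ≡ v₀) (L' : v₀ ≡ v₁) →
           (sym L ∙ cong ψ n ∙ D y₀ ∙ cong g L₁) ∙ cong g (sym L₁ ∙ cong ψ' n' ∙ D' ∙ L')
           ≡ sym L ∙ cong ψ (n ∙ cong d n') ∙ (D y₁ ∙ cong g D') ∙ cong g L'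
  ·-case ψ d ψ' g D refl refl refl refl refl refl = refl

  pair-case : ∀ {ℓ₁ ℓ₂ ℓ₃ ℓ₄} {U₁ : Set ℓ₁} {U₂ : Set ℓ₂} {B₁ : Set ℓ₃} {B₂ : Set ℓ₄}
              (ψ₁ : B₁ → U₁) (ψ₂ : B₂ → U₂) {s₁ t₁ : B₁} {s₂ t₂ : B₂} {n₁ v₁ w₁ : U₁} {n₂ v₂ w₂ : U₂}
              (L₁ : ψ₁ s₁ ≡ n₁) (m₁ : s₁ ≡ t₁) (D₁ : ψ₁ t₁ ≡ v₁) (L₁' : v₁ ≡ w₁)
              (L₂ : ψ₂ s₂ ≡ n₂) (m₂ : s₂ ≡ t₂) (D₂ : ψ₂ t₂ ≡ v₂) (L₂' : v₂ ≡ w₂) →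
              cong₂ _,_ (sym L₁ ∙ cong ψ₁ m₁ ∙ D₁ ∙ L₁') (sym L₂ ∙ cong ψ₂ m₂ ∙ D₂ ∙ L₂')
              ≡ sym (cong₂ _,_ L₁ L₂) ∙ cong (λ y → ψ₁ (proj₁ y) , ψ₂ (proj₂ y)) (cong₂ _,_ m₁ m₂)
                ∙ cong₂ _,_ D₁ D₂ ∙ cong₂ _,_ L₁' L₂'
  pair-case ψ₁ ψ₂ refl refl refl refl refl refl refl refl = refl

open FactoredNaturality

private
  id-id-case : ∀ {ℓ} {A : Set ℓ} {x y : A} (a : x ≡ y) → refl ≡ a ∙ cong (λ z → z) (sym a)
  id-id-case refl = refl

  ·-id-case : ∀ {ℓ₁ ℓ₂ ℓ₃} {S : Set ℓ₁} {V : Set ℓ₂} {U : Set ℓ₃} (g : V → U) (h : S → V)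
              {α : U} {v₁ : V} {s₀ s₁ : S} (a : α ≡ g (h s₀)) (b : v₁ ≡ h s₀) (d : s₁ ≡ s₀) →
              (a ∙ cong g (sym b)) ∙ cong g (b ∙ cong h (sym d)) ≡ a ∙ cong (λ z → g (h z)) (sym d)
  ·-id-case g h a refl refl = trans-reflʳ (a ∙ refl)

  inj-id-case : ∀ {ℓ ℓ'} {A : Set ℓ} {B : Set ℓ'} (f : A → B) {x y : A} (a : x ≡ y) →
                refl ≡ cong f a ∙ cong f (sym a)
  inj-id-case f refl = refl

  pr₁-id-case : ∀ {ℓ ℓ'} {A : Set ℓ} {B : Set ℓ'} {x y : A} {u v : B} (a : x ≡ y) (b : u ≡ v) →
                refl ≡ a ∙ cong proj₁ (sym (cong₂ _,_ a b))
  pr₁-id-case refl refl = refl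

  pr₂-id-case : ∀ {ℓ ℓ'} {A : Set ℓ} {B : Set ℓ'} {x y : A} {u v : B} (a : x ≡ y) (b : u ≡ v) →
                refl ≡ b ∙ cong proj₂ (sym (cong₂ _,_ a b))
  pr₂-id-case refl refl = refl

module _ {A : Code} {X : Set} (cX : ⟦ A ⟧ X → X) where

  id-comm : ∀ x → cX x ≡ cX (fmap A (λ x → x) x)
  id-comm x = cong cX (sym (fmap-id A x))

  natE-id : {S W : Code} (e : PE A S W) (x : ⟦ S ⟧ X) →
            natE cX cX (λ x → x) id-comm e x ≡ fmap-id W (ev cX e x) ∙ cong (ev cX e) (sym (fmap-id S x))
  natE-id {S} id x = id-id-case (fmap-id S x)
  natE-id {S} {W} (_·_ {Q = V} e₁ e₂) x =
    cong₂ _∙_ (natE-id e₂ (ev cX e₁ x)) (cong (cong (ev cX e₂)) (natE-id e₁ x))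
    ∙ ·-id-case (ev cX e₂) (ev cX e₁) (fmap-id W _) (fmap-id V _) (fmap-id S x)
  natE-id constr x = refl
  natE-id (inl {P = P}) x = inj-id-case inj₁ (fmap-id P x)
  natE-id (inr {Q = P}) x = inj-id-case inj₂ (fmap-id P x)
  natE-id (pr₁ {P = P} {Q = P'}) x = pr₁-id-case (fmap-id P (proj₁ x)) (fmap-id P' (proj₂ x))
  natE-id (pr₂ {P = P} {Q = P'}) x = pr₂-id-case (fmap-id P (proj₁ x)) (fmap-id P' (proj₂ x))
  natE-id {S} (⟨_,_⟩ {Q = W₁} {R = W₂} e₁ e₂) x =
    cong₂ (cong₂ _,_) (natE-id e₁ x) (natE-id e₂ x)
    ∙ sym (cong₂-∙-cong _,_ (ev cX e₁) (ev cX e₂) (fmap-id W₁ _) (fmap-id W₂ _) (sym (fmap-id S x)))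
  natE-id {S} (cst z) x = sym (cong-const (sym (fmap-id S x)))
  natE-id (fm g) x = refl

module _ {A : Code} {X Y Z : Set} {cX : ⟦ A ⟧ X → X} {cY : ⟦ A ⟧ Y → Y} {cZ : ⟦ A ⟧ Z → Z}
         (f : X → Y) (fc : ∀ x → f (cX x) ≡ cY (fmap A f x))
         (g : Y → Z) (gc : ∀ y → g (cY y) ≡ cZ (fmap A g y)) where

  ∘-comm : ∀ x → g (f (cX x)) ≡ cZ (fmap A (g ∘ f) x)
  ∘-comm x = cong g (fc x) ∙ gc (fmap A f x) ∙ cong cZ (fmap-∘ A f g x)

  natE-∘ : {S W : Code} (e : PE A S W) (x : ⟦ S ⟧ X) →
           natE cX cZ (g ∘ f) ∘-comm e x
           ≡ sym (fmap-∘ W f g (ev cX e x)) ∙ cong (fmap W g) (natE cX cY f fc e x)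
             ∙ natE cY cZ g gc e (fmap S f x) ∙ cong (ev cZ e) (fmap-∘ S f g x)
  natE-∘ {S} id x = id-case (fmap-∘ S f g x)
  natE-∘ {S} {W} (_·_ {Q = V} e₁ e₂) x =
    cong₂ _∙_ (natE-∘ e₂ (ev cX e₁ x)) (cong (cong (ev cZ e₂)) (natE-∘ e₁ x))
    ∙ ·-case (fmap W g) (ev cY e₂) (fmap V g) (ev cZ e₂) (natE cY cZ g gc e₂)
             (fmap-∘ W f g _) (natE cX cY f fc e₂ _) (fmap-∘ V f g _) (natE cX cY f fc e₁ x)
             (natE cY cZ g gc e₁ (fmap S f x)) (cong (ev cZ e₁) (fmap-∘ S f g x))
    ∙ cong (λ q → sym (fmap-∘ W f g _) ∙ cong (fmap W g) (natE cX cY f fc (e₁ · e₂) x)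
                  ∙ natE cY cZ g gc (e₁ · e₂) (fmap S f x) ∙ q)
           (sym (cong-∘ (fmap-∘ S f g x)))
  natE-∘ constr x = refl
  natE-∘ (inl {P = P}) x = inj-case inj₁ (fmap-∘ P f g x)
  natE-∘ (inr {Q = P}) x = inj-case inj₂ (fmap-∘ P f g x)
  natE-∘ (pr₁ {P = P} {Q = P'}) x = pr₁-case (fmap-∘ P f g (proj₁ x)) (fmap-∘ P' f g (proj₂ x))
  natE-∘ (pr₂ {P = P} {Q = P'}) x = pr₂-case (fmap-∘ P f g (proj₁ x)) (fmap-∘ P' f g (proj₂ x))
  natE-∘ {S} (⟨_,_⟩ {Q = W₁} {R = W₂} e₁ e₂) x =
    cong₂ (cong₂ _,_) (natE-∘ e₁ x) (natE-∘ e₂ x)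
    ∙ pair-case (fmap W₁ g) (fmap W₂ g)
                (fmap-∘ W₁ f g _) (natE cX cY f fc e₁ x) (natE cY cZ g gc e₁ (fmap S f x)) (cong (ev cZ e₁) (fmap-∘ S f g x))
                (fmap-∘ W₂ f g _) (natE cX cY f fc e₂ x) (natE cY cZ g gc e₂ (fmap S f x)) (cong (ev cZ e₂) (fmap-∘ S f g x))
    ∙ cong (λ q → sym (cong₂ _,_ (fmap-∘ W₁ f g _) (fmap-∘ W₂ f g _))
                  ∙ cong (λ y → fmap W₁ g (proj₁ y) , fmap W₂ g (proj₂ y))
                         (cong₂ _,_ (natE cX cY f fc e₁ x) (natE cX cY f fc e₂ x))
                  ∙ cong₂ _,_ (natE cY cZ g gc e₁ (fmap S f x)) (natE cY cZ g gc e₂ (fmap S f x)) ∙ q)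
           (sym (cong-pairing _,_ (ev cZ e₁) (ev cZ e₂) (fmap-∘ S f g x)))
  natE-∘ {S} (cst z) x = sym (cong-const (fmap-∘ S f g x))
  natE-∘ (fm h) x = refl

paste-squares : ∀ {ℓ ℓ' ℓ''} {T : Set ℓ} {X : Set ℓ'} {V : Set ℓ''}
                (k : T → X) (F G : V → X) (H : ∀ v → F v ≡ G v) {α β γl γr : T} {z₀ z₁ : V}
                (u : α ≡ β) (nr : β ≡ γr) (nl : α ≡ γl) (q : γl ≡ γr) → u ∙ nr ≡ nl ∙ q →
                (mr : k γr ≡ G z₀) (ml : k γl ≡ F z₀) → cong k q ∙ mr ≡ ml ∙ H z₀ → (d : z₀ ≡ z₁) →
                cong k u ∙ (cong k nr ∙ mr ∙ cong G d) ≡ (cong k nl ∙ ml ∙ cong F d) ∙ H z₁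
paste-squares k F G H refl refl refl .refl refl mr ml sq refl =
  cong (_∙ refl) sq ∙ trans-reflʳ _ ∙ cong (_∙ H _) (sym (trans-reflʳ ml))

module _ {Σs : Signature} where
  open Signature Σs

  idCell₁ : (X : Alg Σs) → Cell1 Σs X X
  idCell₁ X = record
    { fun = λ x → x
    ; fc = id-comm {A = A} (c X)
    ; fp = λ j x →
        cong (cong (λ z → z) (p X j x) ∙_) (natE-id (c X) (r j) x)
        ∙ id-square (ev (c X) (l j)) (ev (c X) (r j)) (p X j) (fmap-id (Q j) x)
        ∙ cong (_∙ p X j (fmap (Q j) (λ x → x) x)) (sym (natE-id (c X) (l j) x))
    }
    where
      id-square : ∀ {ℓ ℓ'} {V : Set ℓ} {U : Set ℓ'} (F G : V → U) (H : ∀ v → F v ≡ G v) {u₀ u₁ : V} (d : u₀ ≡ u₁) →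
                  cong (λ z → z) (H u₁) ∙ cong G (sym d) ≡ cong F (sym d) ∙ H u₀
      id-square F G H {u} refl = trans-reflʳ (cong (λ z → z) (H u)) ∙ cong-id (H u)

  infixr 9 _·₁_
  _·₁_ : {X Y Z : Alg Σs} → Cell1 Σs X Y → Cell1 Σs Y Z → Cell1 Σs X Z
  _·₁_ {X} {Y} {Z} f g = record
    { fun = fun g ∘ fun f
    ; fc = ∘-comm {A = A} {cX = c X} {cY = c Y} {cZ = c Z} (fun f) (fc f) (fun g) (fc g)
    ; fp = λ j x →
        cong₂ _∙_ (cong-∘ (p X j x)) (natE-∘ {A = A} (fun f) (fc f) (fun g) (fc g) (r j) x)
        ∙ paste-squares (fun g) (ev (c Z) (l j)) (ev (c Z) (r j)) (p Z j)
            (cong (fun f) (p X j x)) (natE (c X) (c Y) (fun f) (fc f) (r j) x)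
            (natE (c X) (c Y) (fun f) (fc f) (l j) x) (p Y j (fmap (Q j) (fun f) x)) (fp f j x)
            (natE (c Y) (c Z) (fun g) (fc g) (r j) _) (natE (c Y) (c Z) (fun g) (fc g) (l j) _) (fp g j _)
            (fmap-∘ (Q j) (fun f) (fun g) x)
        ∙ cong (_∙ p Z j _) (sym (natE-∘ {A = A} (fun f) (fc f) (fun g) (fc g) (l j) x))
    }

-- 1-cells out of a HIT: the constant displayed algebra

module _ {X B : Set} where

  fromConstPathOver : (W : Code) {t₁ t₂ : ⟦ W ⟧ X} (q : t₁ ≡ t₂)
                      {y₁ : D⟦ W ⟧ (λ _ → B) t₁} {y₂ : D⟦ W ⟧ (λ _ → B) t₂} →
                      PathOver (D⟦ W ⟧ (λ _ → B)) q y₁ y₂ → fromConstD W t₁ y₁ ≡ fromConstD W t₂ y₂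
  fromConstPathOver W {t} refl o = cong (fromConstD W t) o

  toConstPathOver : {t₁ t₂ : X} (q : t₁ ≡ t₂) {y₁ y₂ : B} → y₁ ≡ y₂ → PathOver (λ _ → B) q y₁ y₂
  toConstPathOver refl o = o

  fromConstPathOver-toConstPathOver : {t₁ t₂ : X} (q : t₁ ≡ t₂) {y₁ y₂ : B} (o : y₁ ≡ y₂) →
                                      fromConstPathOver I q (toConstPathOver q o) ≡ o
  fromConstPathOver-toConstPathOver refl o = cong-id o

  fromConstPathOver-dsym : (W : Code) {t₁ t₂ : ⟦ W ⟧ X} (q : t₁ ≡ t₂)
                           {y₁ : D⟦ W ⟧ (λ _ → B) t₁} {y₂ : D⟦ W ⟧ (λ _ → B) t₂}
                           (o : PathOver (D⟦ W ⟧ (λ _ → B)) q y₁ y₂) →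
                           fromConstPathOver W (sym q) (dsym {B = D⟦ W ⟧ (λ _ → B)} {p = q} o)
                           ≡ sym (fromConstPathOver W q o)
  fromConstPathOver-dsym W refl o = cong-sym _ o

  fromConstPathOver-dtrans : (W : Code) {t₁ t₂ t₃ : ⟦ W ⟧ X} (q : t₁ ≡ t₂) (q' : t₂ ≡ t₃)
                             {y₁ : D⟦ W ⟧ (λ _ → B) t₁} {y₂ : D⟦ W ⟧ (λ _ → B) t₂} {y₃ : D⟦ W ⟧ (λ _ → B) t₃}
                             (o : PathOver (D⟦ W ⟧ (λ _ → B)) q y₁ y₂) (o' : PathOver (D⟦ W ⟧ (λ _ → B)) q' y₂ y₃) →
                             fromConstPathOver W (q ∙ q') (dtrans {B = D⟦ W ⟧ (λ _ → B)} {p = q} {q = q'} o o')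
                             ≡ fromConstPathOver W q o ∙ fromConstPathOver W q' o'
  fromConstPathOver-dtrans W refl refl o o' = cong-∙ _ o o'

  fromConstPathOver-dpair : {W₁ W₂ : Code} {s₁ s₂ : ⟦ W₁ ⟧ X} {t₁ t₂ : ⟦ W₂ ⟧ X} (q : s₁ ≡ s₂) (q' : t₁ ≡ t₂)
                            {y₁ : D⟦ W₁ ⟧ (λ _ → B) s₁} {y₂ : D⟦ W₁ ⟧ (λ _ → B) s₂}
                            {z₁ : D⟦ W₂ ⟧ (λ _ → B) t₁} {z₂ : D⟦ W₂ ⟧ (λ _ → B) t₂}
                            (o : PathOver (D⟦ W₁ ⟧ (λ _ → B)) q y₁ y₂) (o' : PathOver (D⟦ W₂ ⟧ (λ _ → B)) q' z₁ z₂) →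
                            fromConstPathOver (W₁ ⊗ W₂) (cong₂ _,_ q q')
                              (dpair {B₁ = D⟦ W₁ ⟧ (λ _ → B)} {B₂ = D⟦ W₂ ⟧ (λ _ → B)} {p = q} {q = q'} o o')
                            ≡ cong₂ _,_ (fromConstPathOver W₁ q o) (fromConstPathOver W₂ q' o')
  fromConstPathOver-dpair refl refl refl refl = refl

  fromConstPathOver-∙o : {t₁ t₂ : X} (q : t₁ ≡ t₂) {y₁ y₂ y₂' : B} (o : PathOver (λ _ → B) q y₁ y₂) (e : y₂ ≡ y₂') →
                         fromConstPathOver I q (_∙o_ {B = λ _ → B} {p = q} o e) ≡ fromConstPathOver I q o ∙ e
  fromConstPathOver-∙o refl o refl = sym (trans-reflʳ _)

  fromConstPathOver-o∙ : {t₁ t₂ : X} (q : t₁ ≡ t₂) {y₁ y₁' y₂ : B} (e : y₁ ≡ y₁') (o : PathOver (λ _ → B) q y₁' y₂) →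
                         fromConstPathOver I q (_o∙_ {B = λ _ → B} {p = q} e o) ≡ e ∙ fromConstPathOver I q o
  fromConstPathOver-o∙ refl refl o = refl

  fromConstPathOver-apd : (f : X → B) {t₁ t₂ : X} (q : t₁ ≡ t₂) →
                          fromConstPathOver I q (apd {B = λ _ → B} f q) ≡ cong f q
  fromConstPathOver-apd f refl = refl

  toConstGlobeOver : {t₁ t₂ : X} {q q' : t₁ ≡ t₂} (g : q ≡ q') {y₁ y₂ : B}
                     (o : PathOver (λ _ → B) q y₁ y₂) (o' : PathOver (λ _ → B) q' y₁ y₂) →
                     fromConstPathOver I q o ≡ fromConstPathOver I q' o' → GlobeOver (λ _ → B) g o o'
  toConstGlobeOver {q = refl} refl o o' e = sym (cong-id o) ∙ e ∙ cong-id o'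

module ConstantDisplayedAlgebra (Σs : Signature) (X Y : Alg Σs) where
  open Signature Σs

  ConstY : car X → Set
  ConstY _ = car Y

  constC : (x : ⟦ A ⟧ (car X)) → D⟦ A ⟧ ConstY x → car Y
  constC x y = c Y (fromConstD A x y)

  devC : {S W : Code} (e : PE A S W) (x : ⟦ S ⟧ (car X)) → D⟦ S ⟧ ConstY x → D⟦ W ⟧ ConstY (ev (c X) e x)
  devC = dev {cX = c X} {Y = ConstY} constC

  fromConstD-dev : {S W : Code} (e : PE A S W) (x : ⟦ S ⟧ (car X)) (y : D⟦ S ⟧ ConstY x) →
                   fromConstD W (ev (c X) e x) (devC e x y) ≡ ev (c Y) e (fromConstD S x y)
  fromConstD-dev id x y = refl
  fromConstD-dev (e₁ · e₂) x y = fromConstD-dev e₂ _ (devC e₁ x y) ∙ cong (ev (c Y) e₂) (fromConstD-dev e₁ x y)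
  fromConstD-dev constr x y = refl
  fromConstD-dev inl x y = refl
  fromConstD-dev inr x y = refl
  fromConstD-dev pr₁ x y = refl
  fromConstD-dev pr₂ x y = refl
  fromConstD-dev ⟨ e₁ , e₂ ⟩ x y = cong₂ _,_ (fromConstD-dev e₁ x y) (fromConstD-dev e₂ x y)
  fromConstD-dev (cst z) x y = refl
  fromConstD-dev (fm g) x y = refl

  constP : (j : J) (x : ⟦ Q j ⟧ (car X)) (y : D⟦ Q j ⟧ ConstY x) →
           PathOver ConstY (p X j x) (devC (l j) x y) (devC (r j) x y)
  constP j x y = toConstPathOver (p X j x)
    (fromConstD-dev (l j) x y ∙ p Y j (fromConstD (Q j) x y) ∙ sym (fromConstD-dev (r j) x y))

  fromConstPathOver-dap : {W W' : Code} (e : PE A W W') {t₁ t₂ : ⟦ W ⟧ (car X)} (q : t₁ ≡ t₂)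
                          {y₁ : D⟦ W ⟧ ConstY t₁} {y₂ : D⟦ W ⟧ ConstY t₂} (o : PathOver (D⟦ W ⟧ ConstY) q y₁ y₂) →
                          fromConstPathOver W' (cong (ev (c X) e) q)
                            (dap {B = D⟦ W ⟧ ConstY} {B' = D⟦ W' ⟧ ConstY} (ev (c X) e) (devC e) {p = q} o)
                          ≡ fromConstD-dev e t₁ y₁ ∙ cong (ev (c Y) e) (fromConstPathOver W q o)
                            ∙ sym (fromConstD-dev e t₂ y₂)
  fromConstPathOver-dap e {t} refl {y} refl = sym (trans-symʳ (fromConstD-dev e t y))

  module _ {R' T' : Code} {a' b' : PE A R' T'} (x : ⟦ R' ⟧ (car X)) (y : D⟦ R' ⟧ ConstY x)
           (w : ev (c X) a' x ≡ ev (c X) b' x) (wb : PathOver (D⟦ T' ⟧ ConstY) w (devC a' x y) (devC b' x y)) where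

    private
      δ : {W : Code} (e : PE A R' W) → fromConstD W (ev (c X) e x) (devC e x y) ≡ ev (c Y) e (fromConstD R' x y)
      δ e = fromConstD-dev e x y

    w̃ : ev (c Y) a' (fromConstD R' x y) ≡ ev (c Y) b' (fromConstD R' x y)
    w̃ = sym (δ a') ∙ fromConstPathOver T' w wb ∙ δ b'

    fromConstPathOver-devH :
      {W : Code} {s' t' : PE A R' W} (hh : HE A Q l r a' b' s' t') →
      fromConstPathOver W (evH (c X) (p X) hh x w) (devH {c = c X} {p = p X} constC constP hh x y w wb)
      ≡ δ s' ∙ evH (c Y) (p Y) hh (fromConstD R' x y) w̃ ∙ sym (δ t')
    fromConstPathOver-devH (hrefl e) = conj-refl (δ e) (δ e) refl
    fromConstPathOver-devH {W} (hinv {e₁ = e₁} {e₂} hh) =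
      fromConstPathOver-dsym W (evH (c X) (p X) hh x w) (devH constC constP hh x y w wb)
      ∙ cong sym (fromConstPathOver-devH hh) ∙ sym-conj (δ e₁) (evH (c Y) (p Y) hh _ w̃) (δ e₂)
    fromConstPathOver-devH {W} (hcomp {e₁ = e₁} {e₂} {e₃} h₁ h₂) =
      fromConstPathOver-dtrans W (evH (c X) (p X) h₁ x w) (evH (c X) (p X) h₂ x w)
        (devH constC constP h₁ x y w wb) (devH constC constP h₂ x y w wb)
      ∙ cong₂ _∙_ (fromConstPathOver-devH h₁) (fromConstPathOver-devH h₂)
      ∙ conj-∙ (δ e₁) (evH (c Y) (p Y) h₁ _ w̃) (δ e₂) (evH (c Y) (p Y) h₂ _ w̃) (δ e₃)
    fromConstPathOver-devH (hap {e₁ = e₁} {e₂} e hh) =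
      fromConstPathOver-dap e (evH (c X) (p X) hh x w) (devH constC constP hh x y w wb)
      ∙ cong (λ q → fromConstD-dev e _ (devC e₁ x y) ∙ cong (ev (c Y) e) q ∙ sym (fromConstD-dev e _ (devC e₂ x y)))
             (fromConstPathOver-devH hh)
      ∙ cong-conj (ev (c Y) e) (fromConstD-dev e _ (devC e₁ x y)) (δ e₁) (evH (c Y) (p Y) hh _ w̃) (δ e₂)
                  (fromConstD-dev e _ (devC e₂ x y))
    fromConstPathOver-devH (hassoc e₁ e₂ e₃) =
      conj-refl _ _ (∙-cong-∘ (ev (c Y) e₂) (ev (c Y) e₃) (fromConstD-dev e₃ _ (devC e₂ _ (devC e₁ x y)))
                              (fromConstD-dev e₂ _ (devC e₁ x y)) (δ e₁))
    fromConstPathOver-devH (hlunit e) = conj-refl _ _ (trans-reflʳ (δ e))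
    fromConstPathOver-devH (hrunit e) = conj-refl _ _ (cong-id (δ e))
    fromConstPathOver-devH (hpr₁ e₁ e₂) = conj-refl _ _ (cong-proj₁-cong₂ (δ e₁) (δ e₂))
    fromConstPathOver-devH (hpr₂ e₁ e₂) = conj-refl _ _ (cong-proj₂-cong₂ (δ e₁) (δ e₂))
    fromConstPathOver-devH (hpair {e₁ = e₁} {e₂} {e₃} {e₄} h₁ h₂) =
      fromConstPathOver-dpair (evH (c X) (p X) h₁ x w) (evH (c X) (p X) h₂ x w)
        (devH constC constP h₁ x y w wb) (devH constC constP h₂ x y w wb)
      ∙ cong₂ (cong₂ _,_) (fromConstPathOver-devH h₁) (fromConstPathOver-devH h₂)
      ∙ cong₂-conj _,_ (δ e₁) (evH (c Y) (p Y) h₁ _ w̃) (δ e₂) (δ e₃) (evH (c Y) (p Y) h₂ _ w̃) (δ e₄)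
    fromConstPathOver-devH (hcpair e₁ e₂ e₃) =
      conj-refl _ _ (cong₂-∙-cong _,_ (ev (c Y) e₂) (ev (c Y) e₃)
                                     (fromConstD-dev e₂ _ (devC e₁ x y)) (fromConstD-dev e₃ _ (devC e₁ x y)) (δ e₁))
    fromConstPathOver-devH (hcst e z) = conj-refl _ _ (cong-const (δ e))
    fromConstPathOver-devH (hpath j e) =
      fromConstPathOver-toConstPathOver (p X j (ev (c X) e x)) _
      ∙ conj-homotopy (ev (c Y) (l j)) (ev (c Y) (r j)) (p Y j)
                      (fromConstD-dev (l j) _ (devC e x y)) (fromConstD-dev (r j) _ (devC e x y)) (δ e)
    fromConstPathOver-devH harg = conj-unconj (δ a') (fromConstPathOver T' w wb) (δ b')

  constDispAlg : DispAlg Σs X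
  constDispAlg = record
    { Fam = ConstY
    ; dtrunc = λ _ → trunc Y
    ; dc = constC
    ; dp = constP
    ; dheq = λ k x y w wb →
        toConstGlobeOver (heq X k x w) (devH constC constP (h k) x y w wb) (devH constC constP (h' k) x y w wb)
          (fromConstPathOver-devH x y w wb (h k)
           ∙ cong (λ q → fromConstD-dev (s k) x y ∙ q ∙ sym (fromConstD-dev (t k) x y))
                  (heq Y k (fromConstD (R k) x y) (w̃ {a' = a k} {b' = b k} x y w wb))
           ∙ sym (fromConstPathOver-devH x y w wb (h' k)))
    }

  module _ (f : car X → car Y) (secc : ∀ x → f (c X x) ≡ constC x (dfmap A f x)) where

    private
      L : (P : Code) (x : ⟦ P ⟧ (car X)) → fromConstD P x (dfmap P f x) ≡ fmap P f x
      L P = fromConstD-dfmap P f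

      n : {S W : Code} (e : PE A S W) (x : ⟦ S ⟧ (car X)) → dfmap W f (ev (c X) e x) ≡ devC e x (dfmap S f x)
      n = dnatE {cX = c X} {Y = ConstY} constC f secc

    section-comm : ∀ x → f (c X x) ≡ c Y (fmap A f x)
    section-comm x = secc x ∙ cong (c Y) (L A x)

    natE-section : {S W : Code} (e : PE A S W) (x : ⟦ S ⟧ (car X)) →
                   natE (c X) (c Y) f section-comm e x
                   ≡ sym (L W (ev (c X) e x)) ∙ cong (fromConstD W (ev (c X) e x)) (n e x)
                     ∙ fromConstD-dev e x (dfmap S f x) ∙ cong (ev (c Y) e) (L S x)
    natE-section {S} id x = id-case (L S x)
    natE-section {S} {W} (_·_ {Q = V} e₁ e₂) x =
      cong₂ _∙_ (natE-section e₂ (ev (c X) e₁ x)) (cong (cong (ev (c Y) e₂)) (natE-section e₁ x))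
      ∙ ·-case (fromConstD W (ev (c X) e₂ (ev (c X) e₁ x))) (devC e₂ (ev (c X) e₁ x)) (fromConstD V (ev (c X) e₁ x))
               (ev (c Y) e₂) (fromConstD-dev e₂ (ev (c X) e₁ x))
               (L W _) (n e₂ _) (L V _) (n e₁ x) (fromConstD-dev e₁ x (dfmap S f x)) (cong (ev (c Y) e₁) (L S x))
      ∙ cong (λ q → sym (L W _) ∙ cong (fromConstD W _) (n (e₁ · e₂) x) ∙ fromConstD-dev (e₁ · e₂) x (dfmap S f x) ∙ q)
             (sym (cong-∘ (L S x)))
    natE-section constr x = cong (_∙ cong (c Y) (L A x)) (sym (cong-id (secc x)))
    natE-section (inl {P = P}) x = inj-case inj₁ (L P x)
    natE-section (inr {Q = P}) x = inj-case inj₂ (L P x)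
    natE-section (pr₁ {P = P} {Q = P'}) x = pr₁-case (L P (proj₁ x)) (L P' (proj₂ x))
    natE-section (pr₂ {P = P} {Q = P'}) x = pr₂-case (L P (proj₁ x)) (L P' (proj₂ x))
    natE-section {S} (⟨_,_⟩ {Q = W₁} {R = W₂} e₁ e₂) x =
      cong₂ (cong₂ _,_) (natE-section e₁ x) (natE-section e₂ x)
      ∙ pair-case (fromConstD W₁ (ev (c X) e₁ x)) (fromConstD W₂ (ev (c X) e₂ x))
                  (L W₁ _) (n e₁ x) (fromConstD-dev e₁ x (dfmap S f x)) (cong (ev (c Y) e₁) (L S x))
                  (L W₂ _) (n e₂ x) (fromConstD-dev e₂ x (dfmap S f x)) (cong (ev (c Y) e₂) (L S x))
      ∙ cong (λ q → sym (cong₂ _,_ (L W₁ _) (L W₂ _))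
                    ∙ cong (λ y → fromConstD W₁ (ev (c X) e₁ x) (proj₁ y) , fromConstD W₂ (ev (c X) e₂ x) (proj₂ y))
                           (cong₂ _,_ (n e₁ x) (n e₂ x))
                    ∙ cong₂ _,_ (fromConstD-dev e₁ x (dfmap S f x)) (fromConstD-dev e₂ x (dfmap S f x)) ∙ q)
             (sym (cong-pairing _,_ (ev (c Y) e₁) (ev (c Y) e₂) (L S x)))
    natE-section {S} (cst z) x = sym (cong-const (L S x))
    natE-section (fm g) x = refl

    section-path-comm :
      (∀ j (x : ⟦ Q j ⟧ (car X)) → SquareOver ConstY (refl {x = p X j x}) (n (l j) x) (n (r j) x)
                                      (apd {B = ConstY} f (p X j x)) (constP j x (dfmap (Q j) f x))) →
      ∀ j (x : ⟦ Q j ⟧ (car X)) →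
      trans (cong f (p X j x)) (natE (c X) (c Y) f section-comm (r j) x)
      ≡ trans (natE (c X) (c Y) f section-comm (l j) x) (p Y j (fmap (Q j) f x))
    section-path-comm secp j x =
      cong (cong f (p X j x) ∙_) (natE-section (r j) x)
      ∙ square (ev (c Y) (l j)) (ev (c Y) (r j)) (p Y j) (cong f (p X j x)) (n (l j) x) (n (r j) x)
               (fromConstD-dev (l j) x (dfmap (Q j) f x)) (fromConstD-dev (r j) x (dfmap (Q j) f x)) (L (Q j) x)
               (cong (_∙ n (r j) x) (sym (fromConstPathOver-apd f (p X j x)))
                ∙ sym (fromConstPathOver-∙o (p X j x) (apd {B = ConstY} f (p X j x)) (n (r j) x))
                ∙ cong (fromConstPathOver I (p X j x)) (secp j x)
                ∙ fromConstPathOver-o∙ (p X j x) (n (l j) x) (constP j x (dfmap (Q j) f x))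
                ∙ cong (n (l j) x ∙_) (fromConstPathOver-toConstPathOver (p X j x) _))
      ∙ cong (_∙ p Y j (fmap (Q j) f x)) (sym (natE-section (l j) x))
      where
        square : ∀ {ℓ ℓ'} {V : Set ℓ} {U : Set ℓ'} (F G : V → U) (H : ∀ u → F u ≡ G u)
                 {γ δ α β : U} {u₀ u₁ : V}
                 (q : γ ≡ δ) (nl : γ ≡ α) (nr : δ ≡ β) (dl : α ≡ F u₀) (dr : β ≡ G u₀) (d : u₀ ≡ u₁) →
                 q ∙ nr ≡ nl ∙ (dl ∙ H u₀ ∙ sym dr) →
                 q ∙ (cong (λ z → z) nr ∙ dr ∙ cong G d) ≡ (cong (λ z → z) nl ∙ dl ∙ cong F d) ∙ H u₁
        square F G H q refl refl refl refl refl sq = sq ∙ trans-reflʳ _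

  section→cell₁ : Section Σs constDispAlg → Cell1 Σs X Y
  section→cell₁ σ = record
    { fun = sec σ
    ; fc = section-comm (sec σ) (secc σ)
    ; fp = section-path-comm (sec σ) (secc σ) (secp σ)
    }

-- 2-cells out of a HIT: the displayed algebra of paths between two 1-cells

module PathDisplayedAlgebra (Σs : Signature) (X Y : Alg Σs) (f g : Cell1 Σs X Y) where
  open Signature Σs

  Paths : car X → Set
  Paths x = fun f x ≡ fun g x

  pathC : (x : ⟦ A ⟧ (car X)) → D⟦ A ⟧ Paths x → Paths (c X x)
  pathC x y = fc f x ∙ cong (c Y) (fromPathD A x y) ∙ sym (fc g x)

  devP : {S W : Code} (e : PE A S W) (x : ⟦ S ⟧ (car X)) → D⟦ S ⟧ Paths x → D⟦ W ⟧ Paths (ev (c X) e x)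
  devP = dev {cX = c X} {Y = Paths} pathC

  private
    nf : {S W : Code} (e : PE A S W) (x : ⟦ S ⟧ (car X)) → fmap W (fun f) (ev (c X) e x) ≡ ev (c Y) e (fmap S (fun f) x)
    nf = natE (c X) (c Y) (fun f) (fc f)

    ng : {S W : Code} (e : PE A S W) (x : ⟦ S ⟧ (car X)) → fmap W (fun g) (ev (c X) e x) ≡ ev (c Y) e (fmap S (fun g) x)
    ng = natE (c X) (c Y) (fun g) (fc g)

  fromPathD-dev : {S W : Code} (e : PE A S W) (x : ⟦ S ⟧ (car X)) (y : D⟦ S ⟧ Paths x) →
                  fromPathD W (ev (c X) e x) (devP e x y) ≡ nf e x ∙ cong (ev (c Y) e) (fromPathD S x y) ∙ sym (ng e x)
  fromPathD-dev {S} id x y = sym (trans-reflʳ _ ∙ cong-id (fromPathD S x y))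
  fromPathD-dev {S} (e₁ · e₂) x y =
    fromPathD-dev e₂ (ev (c X) e₁ x) (devP e₁ x y)
    ∙ cong (λ q → nf e₂ _ ∙ cong (ev (c Y) e₂) q ∙ sym (ng e₂ _)) (fromPathD-dev e₁ x y)
    ∙ cong-conj (ev (c Y) e₂) (nf e₂ _) (nf e₁ x) (cong (ev (c Y) e₁) (fromPathD S x y)) (ng e₁ x) (ng e₂ _)
    ∙ cong (λ q → nf (e₁ · e₂) x ∙ q ∙ sym (ng (e₁ · e₂) x)) (sym (cong-∘ (fromPathD S x y)))
  fromPathD-dev constr x y = refl
  fromPathD-dev inl x y = sym (trans-reflʳ _)
  fromPathD-dev inr x y = sym (trans-reflʳ _)
  fromPathD-dev (pr₁ {P = P} {Q = P'}) x y =
    sym (trans-reflʳ _ ∙ cong-proj₁-cong₂ (fromPathD P (proj₁ x) (proj₁ y)) (fromPathD P' (proj₂ x) (proj₂ y)))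
  fromPathD-dev (pr₂ {P = P} {Q = P'}) x y =
    sym (trans-reflʳ _ ∙ cong-proj₂-cong₂ (fromPathD P (proj₁ x) (proj₁ y)) (fromPathD P' (proj₂ x) (proj₂ y)))
  fromPathD-dev {S} ⟨ e₁ , e₂ ⟩ x y =
    cong₂ (cong₂ _,_) (fromPathD-dev e₁ x y) (fromPathD-dev e₂ x y)
    ∙ cong₂-conj _,_ (nf e₁ x) (cong (ev (c Y) e₁) (fromPathD S x y)) (ng e₁ x)
                     (nf e₂ x) (cong (ev (c Y) e₂) (fromPathD S x y)) (ng e₂ x)
    ∙ cong (λ q → nf ⟨ e₁ , e₂ ⟩ x ∙ q ∙ sym (ng ⟨ e₁ , e₂ ⟩ x))
           (sym (cong-pairing _,_ (ev (c Y) e₁) (ev (c Y) e₂) (fromPathD S x y)))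
  fromPathD-dev {S} (cst z) x y = sym (trans-reflʳ _ ∙ cong-const (fromPathD S x y))
  fromPathD-dev (fm h) x y = refl

  toPathsPathOver : {t₁ t₂ : car X} (q : t₁ ≡ t₂) {b₁ : Paths t₁} {b₂ : Paths t₂} →
                    b₁ ∙ cong (fun g) q ≡ cong (fun f) q ∙ b₂ → PathOver Paths q b₁ b₂
  toPathsPathOver refl {b₁} e = sym (trans-reflʳ b₁) ∙ e

  pathP : (j : J) (x : ⟦ Q j ⟧ (car X)) (y : D⟦ Q j ⟧ Paths x) →
          PathOver Paths (p X j x) (devP (l j) x y) (devP (r j) x y)
  pathP j x y = toPathsPathOver (p X j x)
    (cong (_∙ cong (fun g) (p X j x)) (fromPathD-dev (l j) x y)
     ∙ square (ev (c Y) (l j)) (ev (c Y) (r j)) (p Y j) (fromPathD (Q j) x y)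
              (cong (fun f) (p X j x)) (cong (fun g) (p X j x))
              (nf (l j) x) (nf (r j) x) (ng (l j) x) (ng (r j) x) (fp f j x) (fp g j x)
     ∙ cong (cong (fun f) (p X j x) ∙_) (sym (fromPathD-dev (r j) x y)))
    where
      square : ∀ {ℓ ℓ'} {V : Set ℓ} {U : Set ℓ'} (F G : V → U) (H : ∀ u → F u ≡ G u)
               {u₀ u₁ : V} {α β α' β' : U} (d : u₀ ≡ u₁) (qf : α ≡ β) (qg : α' ≡ β')
               (nfl : α ≡ F u₀) (nfr : β ≡ G u₀) (ngl : α' ≡ F u₁) (ngr : β' ≡ G u₁) →
               qf ∙ nfr ≡ nfl ∙ H u₀ → qg ∙ ngr ≡ ngl ∙ H u₁ →
               (nfl ∙ cong F d ∙ sym ngl) ∙ qg ≡ qf ∙ (nfr ∙ cong G d ∙ sym ngr)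
      square F G H refl qf qg refl refl refl refl sqf sqg = sym (trans-reflʳ qg) ∙ sqg ∙ sym sqf

  pathDispAlg : DispAlg Σs X
  pathDispAlg = record
    { Fam = Paths
    ; dtrunc = λ t → isSet→is1Type (isSetPaths t)
    ; dc = pathC
    ; dp = pathP
    ; dheq = λ k x y w wb → isSet→GlobeOver Paths isSetPaths (heq X k x w) _ _
    }
    where
      isSetPaths : ∀ t → isSet (Paths t)
      isSetPaths t = trunc Y (fun f t) (fun g t)

  section→cell₂ : Section Σs pathDispAlg → Cell2 Σs f g
  section→cell₂ σ = record
    { θ = sec σ
    ; θc = λ x → cong (_∙ fc g x) (secc σ x)
                 ∙ conj-∙-sym (fc f x) (cong (c Y) (fromPathD A x (dfmap A (sec σ) x))) (fc g x)
                 ∙ cong (λ q → fc f x ∙ cong (c Y) q) (fromPathD-dfmap (sec σ) A x)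
    }

-- Uniqueness of 2-cells out of a HIT

module _ (ua : Univalence lzero) {Σs : Signature} {X Y : Alg Σs} {f g : Cell1 Σs X Y} where
  open FunExt ua

  Cell2-≡ : (α β : Cell2 Σs f g) → θ α ≡ θ β → α ≡ β
  Cell2-≡ record { θ = t ; θc = tc } record { θ = .t ; θc = tc' } refl =
    cong (λ tc → record { θ = t ; θc = tc }) (isPropΠ (λ x → trunc Y _ _ _ _) tc tc')

module EqualityDisplayedAlgebra (ua : Univalence lzero) (Σs : Signature) (X Y : Alg Σs)
                                {f g : Cell1 Σs X Y} (α β : Cell2 Σs f g) where
  open Signature Σs
  open FunExt ua

  Eqs : car X → Set
  Eqs x = θ α x ≡ θ β x

  isPropEqs : ∀ t → isProp (Eqs t)
  isPropEqs t = trunc Y _ _ (θ α t) (θ β t)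

  eqC : (x : ⟦ A ⟧ (car X)) → D⟦ A ⟧ Eqs x → Eqs (c X x)
  eqC x y = trans-injectiveˡ (fc g x) (θc α x ∙ cong (λ q → fc f x ∙ cong (c Y) q) (fromPath²D A x y) ∙ sym (θc β x))

  eqDispAlg : DispAlg Σs X
  eqDispAlg = record
    { Fam = Eqs
    ; dtrunc = λ t → isSet→is1Type (isProp→isSet (isPropEqs t))
    ; dc = eqC
    ; dp = λ j x y → isProp→PathOver Eqs isPropEqs (p X j x) _ _
    ; dheq = λ k x y w wb → isSet→GlobeOver Eqs (λ t → isProp→isSet (isPropEqs t)) (heq X k x w) _ _
    }

  section→≡ : Section Σs eqDispAlg → α ≡ β
  section→≡ σ = Cell2-≡ ua α β (funExt (sec σ))

module TotalAlgebra (Σs : Signature) (X : Alg Σs) (D : DispAlg Σs X) where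
  open Signature Σs

  TX : Set
  TX = Σ (car X) (Fam D)

  ΣD : Code → Set
  ΣD P = Σ (⟦ P ⟧ (car X)) (D⟦ P ⟧ (Fam D))

  sndD : (P : Code) (z : ⟦ P ⟧ TX) → D⟦ P ⟧ (Fam D) (fmap P proj₁ z)
  sndD (C Z _) z = tt
  sndD I z = proj₂ z
  sndD (P ⊕ P') (inj₁ z) = sndD P z
  sndD (P ⊕ P') (inj₂ z) = sndD P' z
  sndD (P ⊗ P') z = sndD P (proj₁ z) , sndD P' (proj₂ z)

  split : (P : Code) → ⟦ P ⟧ TX → ΣD P
  split P z = fmap P proj₁ z , sndD P z

  totalC : ⟦ A ⟧ TX → TX
  totalC z = c X (fmap A proj₁ z) , dc D (fmap A proj₁ z) (sndD A z)

  evΣ : {S W : Code} (e : PE A S W) → ΣD S → ΣD W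
  evΣ e w = ev (c X) e (proj₁ w) , dev (dc D) e (proj₁ w) (proj₂ w)

  split-ev : {S W : Code} (e : PE A S W) (z : ⟦ S ⟧ TX) → split W (ev totalC e z) ≡ evΣ e (split S z)
  split-ev id z = refl
  split-ev (e₁ · e₂) z = split-ev e₂ (ev totalC e₁ z) ∙ cong (evΣ e₂) (split-ev e₁ z)
  split-ev constr z = refl
  split-ev inl z = refl
  split-ev inr z = refl
  split-ev pr₁ z = refl
  split-ev pr₂ z = refl
  split-ev ⟨ e₁ , e₂ ⟩ z = cong₂ regroup (split-ev e₁ z) (split-ev e₂ z)
  split-ev (cst x) z = refl
  split-ev (fm g) z = refl

  pathΣ : (j : J) (w : ΣD (Q j)) → evΣ (l j) w ≡ evΣ (r j) w
  pathΣ j w = ΣPath (p X j (proj₁ w)) (dp D j (proj₁ w) (proj₂ w))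

  totalP : (j : J) (z : ⟦ Q j ⟧ TX) → ev totalC (l j) z ≡ ev totalC (r j) z
  totalP j z = split-ev (l j) z ∙ pathΣ j (split (Q j) z) ∙ sym (split-ev (r j) z)

  cong-split-ev : {W W' : Code} (e : PE A W W') {u v : ⟦ W ⟧ TX} (q : u ≡ v) →
                  cong (split W') (cong (ev totalC e) q)
                  ≡ split-ev e u ∙ cong (evΣ e) (cong (split W) q) ∙ sym (split-ev e v)
  cong-split-ev e {u} refl = sym (trans-symʳ (split-ev e u))

  cong-split-cong₂ : {W₁ W₂ : Code} {u u' : ⟦ W₁ ⟧ TX} {v v' : ⟦ W₂ ⟧ TX} (q : u ≡ u') (q' : v ≡ v') →
                     cong (split (W₁ ⊗ W₂)) (cong₂ _,_ q q') ≡ cong₂ regroup (cong (split W₁) q) (cong (split W₂) q')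
  cong-split-cong₂ refl refl = refl

  cong-evΣ-pr₁ : {P P' : Code} {u u' : ΣD P} {v v' : ΣD P'} (g₁ : u ≡ u') (g₂ : v ≡ v') →
                 cong (evΣ (pr₁ {P = P} {Q = P'})) (cong₂ regroup g₁ g₂) ≡ g₁
  cong-evΣ-pr₁ refl refl = refl

  cong-evΣ-pr₂ : {P P' : Code} {u u' : ΣD P} {v v' : ΣD P'} (g₁ : u ≡ u') (g₂ : v ≡ v') →
                 cong (evΣ (pr₂ {P = P} {Q = P'})) (cong₂ regroup g₁ g₂) ≡ g₂
  cong-evΣ-pr₂ refl refl = refl

  module _ {R' T' : Code} {a' b' : PE A R' T'} (z : ⟦ R' ⟧ TX) (w : ev totalC a' z ≡ ev totalC b' z) where

    wΣ : evΣ a' (split R' z) ≡ evΣ b' (split R' z)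
    wΣ = sym (split-ev a' z) ∙ cong (split T') w ∙ split-ev b' z

    private
      σ : {W : Code} (e : PE A R' W) → split W (ev totalC e z) ≡ evΣ e (split R' z)
      σ e = split-ev e z

      evHX : {W : Code} {s' t' : PE A R' W} → HE A Q l r a' b' s' t' →
             ev (c X) s' (fmap R' proj₁ z) ≡ ev (c X) t' (fmap R' proj₁ z)
      evHX hh = evH (c X) (p X) hh (fmap R' proj₁ z) (cong proj₁ wΣ)

      devHD : {W : Code} {s' t' : PE A R' W} (hh : HE A Q l r a' b' s' t') →
              PathOver (D⟦ W ⟧ (Fam D)) (evHX hh)
                (dev (dc D) s' (fmap R' proj₁ z) (sndD R' z)) (dev (dc D) t' (fmap R' proj₁ z) (sndD R' z))
      devHD hh = devH {c = c X} {p = p X} (dc D) (dp D) hh (fmap R' proj₁ z) (sndD R' z) (cong proj₁ wΣ) (unΣPath wΣ)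

    evHΣ : {W : Code} {s' t' : PE A R' W} → HE A Q l r a' b' s' t' → evΣ s' (split R' z) ≡ evΣ t' (split R' z)
    evHΣ hh = ΣPath (evHX hh) (devHD hh)

    cong-split-evH : {W : Code} {s' t' : PE A R' W} (hh : HE A Q l r a' b' s' t') →
                     cong (split W) (evH totalC totalP hh z w) ≡ σ s' ∙ evHΣ hh ∙ sym (σ t')
    cong-split-evH (hrefl e) = conj-refl (σ e) (σ e) refl
    cong-split-evH {W} (hinv {e₁ = e₁} {e₂} hh) =
      cong-sym (split W) (evH totalC totalP hh z w) ∙ cong sym (cong-split-evH hh)
      ∙ sym-conj (σ e₁) (evHΣ hh) (σ e₂)
      ∙ cong (λ q → σ e₂ ∙ q ∙ sym (σ e₁)) (sym (ΣPath-dsym (evHX hh) (devHD hh)))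
    cong-split-evH {W} (hcomp {e₁ = e₁} {e₂} {e₃} h₁ h₂) =
      cong-∙ (split W) (evH totalC totalP h₁ z w) (evH totalC totalP h₂ z w)
      ∙ cong₂ _∙_ (cong-split-evH h₁) (cong-split-evH h₂)
      ∙ conj-∙ (σ e₁) (evHΣ h₁) (σ e₂) (evHΣ h₂) (σ e₃)
      ∙ cong (λ q → σ e₁ ∙ q ∙ sym (σ e₃)) (sym (ΣPath-dtrans (evHX h₁) (evHX h₂) (devHD h₁) (devHD h₂)))
    cong-split-evH (hap {e₁ = e₁} {e₂} e hh) =
      cong-split-ev e (evH totalC totalP hh z w)
      ∙ cong (λ q → split-ev e (ev totalC e₁ z) ∙ cong (evΣ e) q ∙ sym (split-ev e (ev totalC e₂ z))) (cong-split-evH hh)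
      ∙ cong-conj (evΣ e) (split-ev e (ev totalC e₁ z)) (σ e₁) (evHΣ hh) (σ e₂) (split-ev e (ev totalC e₂ z))
      ∙ cong (λ q → (split-ev e (ev totalC e₁ z) ∙ cong (evΣ e) (σ e₁)) ∙ q
                    ∙ sym (split-ev e (ev totalC e₂ z) ∙ cong (evΣ e) (σ e₂)))
             (sym (ΣPath-dap (ev (c X) e) (dev (dc D) e) (evHX hh) (devHD hh)))
    cong-split-evH (hassoc e₁ e₂ e₃) =
      conj-refl _ _ (∙-cong-∘ (evΣ e₂) (evΣ e₃) (split-ev e₃ (ev totalC e₂ (ev totalC e₁ z)))
                              (split-ev e₂ (ev totalC e₁ z)) (σ e₁))
    cong-split-evH (hlunit e) = conj-refl _ _ (trans-reflʳ (σ e))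
    cong-split-evH (hrunit e) = conj-refl _ _ (cong-id (σ e))
    cong-split-evH (hpr₁ {W₁} {W₂} e₁ e₂) = conj-refl _ (σ e₁) (cong-evΣ-pr₁ {P = W₁} {P' = W₂} (σ e₁) (σ e₂))
    cong-split-evH (hpr₂ {W₁} {W₂} e₁ e₂) = conj-refl _ (σ e₂) (cong-evΣ-pr₂ {P = W₁} {P' = W₂} (σ e₁) (σ e₂))
    cong-split-evH (hpair {W₁} {W₂} {e₁} {e₂} {e₃} {e₄} h₁ h₂) =
      cong-split-cong₂ {W₁ = W₁} {W₂ = W₂} (evH totalC totalP h₁ z w) (evH totalC totalP h₂ z w)
      ∙ cong₂ (cong₂ regroup) (cong-split-evH h₁) (cong-split-evH h₂)
      ∙ cong₂-conj regroup (σ e₁) (evHΣ h₁) (σ e₂) (σ e₃) (evHΣ h₂) (σ e₄)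
      ∙ cong (λ q → cong₂ regroup (σ e₁) (σ e₃) ∙ q ∙ sym (cong₂ regroup (σ e₂) (σ e₄)))
             (sym (ΣPath-dpair (evHX h₁) (evHX h₂) (devHD h₁) (devHD h₂)))
    cong-split-evH (hcpair e₁ e₂ e₃) =
      conj-refl _ _ (cong₂-∙-cong regroup (evΣ e₂) (evΣ e₃)
                                  (split-ev e₂ (ev totalC e₁ z)) (split-ev e₃ (ev totalC e₁ z)) (σ e₁))
    cong-split-evH (hcst e x) = conj-refl _ _ (cong-const (σ e))
    cong-split-evH (hpath j e) =
      cong-id (totalP j (ev totalC e z))
      ∙ conj-homotopy (evΣ (l j)) (evΣ (r j)) (pathΣ j)
                      (split-ev (l j) (ev totalC e z)) (split-ev (r j) (ev totalC e z)) (σ e)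
    cong-split-evH harg =
      conj-unconj (σ a') (cong (split T') w) (σ b') ∙ cong (λ q → σ a' ∙ q ∙ sym (σ b')) (sym (ΣPath-unΣPath wΣ))

  totalHeq : (k : K) (z : ⟦ R k ⟧ TX) (w : ev totalC (a k) z ≡ ev totalC (b k) z) →
             evH totalC totalP (h k) z w ≡ evH totalC totalP (h' k) z w
  totalHeq k z w =
    sym (cong-id (evH totalC totalP (h k) z w)) ∙ cong-split-evH z w (h k)
    ∙ cong (λ q → split-ev (s k) z ∙ q ∙ sym (split-ev (t k) z))
           (ΣPath-GlobeOver (heq X k (fmap (R k) proj₁ z) (cong proj₁ wΣ')) _ _
                            (dheq D k (fmap (R k) proj₁ z) (sndD (R k) z) (cong proj₁ wΣ') (unΣPath wΣ')))
    ∙ sym (cong-split-evH z w (h' k)) ∙ cong-id (evH totalC totalP (h' k) z w)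
    where
      wΣ' : evΣ (a k) (split (R k) z) ≡ evΣ (b k) (split (R k) z)
      wΣ' = wΣ {a' = a k} {b' = b k} z w

  totalAlg : Alg Σs
  totalAlg = record
    { car = TX
    ; trunc = is1TypeΣ (trunc X) (dtrunc D)
    ; c = totalC
    ; p = totalP
    ; heq = totalHeq
    }

  private
    natE-proj₁ : {S W : Code} (e : PE A S W) (z : ⟦ S ⟧ TX) →
                 fmap W proj₁ (ev totalC e z) ≡ ev (c X) e (fmap S proj₁ z)
    natE-proj₁ = natE totalC (c X) proj₁ (λ _ → refl)

    cong-proj₁-regroup : {P P' : Code} {u u' : ΣD P} {v v' : ΣD P'} (g₁ : u ≡ u') (g₂ : v ≡ v') →
                         cong proj₁ (cong₂ regroup g₁ g₂) ≡ cong₂ _,_ (cong proj₁ g₁) (cong proj₁ g₂)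
    cong-proj₁-regroup refl refl = refl

  cong-proj₁-split-ev : {S W : Code} (e : PE A S W) (z : ⟦ S ⟧ TX) → cong proj₁ (split-ev e z) ≡ natE-proj₁ e z
  cong-proj₁-split-ev id z = refl
  cong-proj₁-split-ev (e₁ · e₂) z =
    cong-∙ proj₁ (split-ev e₂ (ev totalC e₁ z)) (cong (evΣ e₂) (split-ev e₁ z))
    ∙ cong₂ _∙_ (cong-proj₁-split-ev e₂ (ev totalC e₁ z))
                (sym (cong-∘ (split-ev e₁ z)) ∙ cong-∘ (split-ev e₁ z)
                 ∙ cong (cong (ev (c X) e₂)) (cong-proj₁-split-ev e₁ z))
  cong-proj₁-split-ev constr z = refl
  cong-proj₁-split-ev inl z = refl
  cong-proj₁-split-ev inr z = refl
  cong-proj₁-split-ev pr₁ z = refl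
  cong-proj₁-split-ev pr₂ z = refl
  cong-proj₁-split-ev (⟨_,_⟩ {Q = W₁} {R = W₂} e₁ e₂) z =
    cong-proj₁-regroup {P = W₁} {P' = W₂} (split-ev e₁ z) (split-ev e₂ z)
    ∙ cong₂ (cong₂ _,_) (cong-proj₁-split-ev e₁ z) (cong-proj₁-split-ev e₂ z)
  cong-proj₁-split-ev (cst x) z = refl
  cong-proj₁-split-ev (fm g) z = refl

  projCell : Cell1 Σs totalAlg X
  projCell = record
    { fun = proj₁
    ; fc = λ _ → refl
    ; fp = λ j z →
        cong (_∙ natE-proj₁ (r j) z)
          (cong-∙ proj₁ (split-ev (l j) z) (pathΣ j (split (Q j) z) ∙ sym (split-ev (r j) z))
           ∙ cong₂ _∙_ (cong-proj₁-split-ev (l j) z)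
               (cong-∙ proj₁ (pathΣ j (split (Q j) z)) (sym (split-ev (r j) z))
                ∙ cong₂ _∙_ (cong-proj₁-ΣPath (p X j (fmap (Q j) proj₁ z)) (dp D j (fmap (Q j) proj₁ z) (sndD (Q j) z)))
                            (cong-sym proj₁ (split-ev (r j) z) ∙ cong sym (cong-proj₁-split-ev (r j) z))))
        ∙ conj-∙-sym (natE-proj₁ (l j) z) (p X j (fmap (Q j) proj₁ z)) (natE-proj₁ (r j) z)
    }

  module SectionFromCell
    (b₀ : (x : car X) → Fam D x)
    (fcu : ∀ x → _≡_ {A = TX} (c X x , b₀ (c X x)) (totalC (fmap A (λ x → x , b₀ x) x)))
    (fpu : ∀ j (x : ⟦ Q j ⟧ (car X)) →
           trans (cong (λ x → x , b₀ x) (p X j x)) (natE (c X) totalC (λ x → x , b₀ x) fcu (r j) x)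
           ≡ trans (natE (c X) totalC (λ x → x , b₀ x) fcu (l j) x) (totalP j (fmap (Q j) (λ x → x , b₀ x) x)))
    where

    u : Cell1 Σs X totalAlg
    u = record { fun = λ x → x , b₀ x ; fc = fcu ; fp = fpu }

    module _ (fc-id : ∀ x → fc (u ·₁ projCell) x ≡ fc (idCell₁ X) x) where
      open FibrePaths (Fam D) (trunc X)

      s₀ : car X → TX
      s₀ x = x , b₀ x

      dfmap-split : (P : Code) (x : ⟦ P ⟧ (car X)) → _≡_ {A = ΣD P} (x , dfmap P b₀ x) (split P (fmap P s₀ x))
      dfmap-split (C Z _) x = refl
      dfmap-split I x = refl
      dfmap-split (P ⊕ P') (inj₁ x) = cong (evΣ (inl {P = P} {Q = P'})) (dfmap-split P x)
      dfmap-split (P ⊕ P') (inj₂ x) = cong (evΣ (inr {P = P} {Q = P'})) (dfmap-split P' x)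
      dfmap-split (P ⊗ P') x = cong₂ regroup (dfmap-split P (proj₁ x)) (dfmap-split P' (proj₂ x))

      cong-proj₁-dfmap-split : (P : Code) (x : ⟦ P ⟧ (car X)) →
                               cong proj₁ (dfmap-split P x) ≡ sym (fmap-∘ P s₀ proj₁ x ∙ fmap-id P x)
      cong-proj₁-dfmap-split (C Z _) x = refl
      cong-proj₁-dfmap-split I x = refl
      cong-proj₁-dfmap-split (P ⊕ P') (inj₁ x) =
        sym (cong-∘ (dfmap-split P x)) ∙ cong-∘ (dfmap-split P x) ∙ cong (cong inj₁) (cong-proj₁-dfmap-split P x)
        ∙ cong-sym inj₁ _ ∙ cong sym (cong-∙ inj₁ (fmap-∘ P s₀ proj₁ x) (fmap-id P x))
      cong-proj₁-dfmap-split (P ⊕ P') (inj₂ x) =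
        sym (cong-∘ (dfmap-split P' x)) ∙ cong-∘ (dfmap-split P' x) ∙ cong (cong inj₂) (cong-proj₁-dfmap-split P' x)
        ∙ cong-sym inj₂ _ ∙ cong sym (cong-∙ inj₂ (fmap-∘ P' s₀ proj₁ x) (fmap-id P' x))
      cong-proj₁-dfmap-split (P ⊗ P') x =
        cong-proj₁-regroup {P = P} {P' = P'} (dfmap-split P (proj₁ x)) (dfmap-split P' (proj₂ x))
        ∙ cong₂ (cong₂ _,_) (cong-proj₁-dfmap-split P (proj₁ x)) (cong-proj₁-dfmap-split P' (proj₂ x))
        ∙ cong₂-sym-∙ (fmap-∘ P s₀ proj₁ (proj₁ x)) (fmap-id P (proj₁ x)) (fmap-∘ P' s₀ proj₁ (proj₂ x)) (fmap-id P' (proj₂ x))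
        where
          cong₂-sym-∙ : ∀ {ℓ ℓ'} {A : Set ℓ} {B : Set ℓ'} {x y z : A} {u v w : B}
                        (p : x ≡ y) (q : y ≡ z) (p' : u ≡ v) (q' : v ≡ w) →
                        cong₂ _,_ (sym (p ∙ q)) (sym (p' ∙ q')) ≡ sym (cong₂ _,_ p p' ∙ cong₂ _,_ q q')
          cong₂-sym-∙ refl refl refl refl = refl

      fcu-fibre : ∀ x → _≡_ {A = TX} (c X x , b₀ (c X x)) (c X x , dc D x (dfmap A b₀ x))
      fcu-fibre x = fcu x ∙ sym (cong (evΣ constr) (dfmap-split A x))

      -- fc-id is exactly what makes the constructor path of s₀ lie over refl.
      cong-proj₁-fcu-fibre : ∀ x → cong proj₁ (fcu-fibre x) ≡ refl
      cong-proj₁-fcu-fibre x =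
        cong-∙ proj₁ (fcu x) (sym (cong (evΣ constr) (dfmap-split A x)))
        ∙ cong (cong proj₁ (fcu x) ∙_)
               (cong-sym proj₁ (cong (evΣ constr) (dfmap-split A x))
                ∙ cong sym (sym (cong-∘ (dfmap-split A x)) ∙ cong-∘ (dfmap-split A x)
                            ∙ cong (cong (c X)) (cong-proj₁-dfmap-split A x)))
        ∙ cancel (c X) (cong proj₁ (fcu x)) (fmap-∘ A s₀ proj₁ x) (fmap-id A x) (fc-id x)
        where
          cancel : ∀ {ℓ ℓ'} {A : Set ℓ} {B : Set ℓ'} (k : A → B) {u v w : A}
                   (a : k w ≡ k u) (q : u ≡ v) (q' : v ≡ w) → a ∙ cong k q ≡ cong k (sym q') →
                   a ∙ sym (cong k (sym (q ∙ q'))) ≡ refl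
          cancel k a refl refl e = e

      section-comm : ∀ x → b₀ (c X x) ≡ dc D x (dfmap A b₀ x)
      section-comm x = fibrePath (fcu-fibre x) (cong-proj₁-fcu-fibre x)

      private
        n : {S W : Code} (e : PE A S W) (x : ⟦ S ⟧ (car X)) → dfmap W b₀ (ev (c X) e x) ≡ dev (dc D) e x (dfmap S b₀ x)
        n = dnatE {cX = c X} {Y = Fam D} (dc D) b₀ section-comm

        ns : {S W : Code} (e : PE A S W) (x : ⟦ S ⟧ (car X)) → fmap W s₀ (ev (c X) e x) ≡ ev totalC e (fmap S s₀ x)
        ns = natE (c X) totalC s₀ fcu

        ·-pairing-case :
          {X₁ X₂ : Set} {B₁ : X₁ → Set} {B₂ : X₂ → Set} (g₁ : X₁ → X₂) (g₂ : ∀ x → B₁ x → B₂ (g₁ x))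
          {a : X₁} {yv yv' : B₁ a} {yw : B₂ (g₁ a)} {φ ξ ξ' : Σ X₂ B₂} {w₂ w₄ w₅ : Σ X₁ B₁}
          (m : φ ≡ (g₁ a , yw)) (d₂ : yw ≡ g₂ a yv) (γ : (a , yv) ≡ w₂)
          (E₂ : ξ ≡ (g₁ (proj₁ w₂) , g₂ (proj₁ w₂) (proj₂ w₂)))
          (d₁ : yv ≡ yv') (γ' : (a , yv') ≡ w₄) (E₁ : w₅ ≡ w₄)
          (E₂' : ξ' ≡ (g₁ (proj₁ w₅) , g₂ (proj₁ w₅) (proj₂ w₅))) →
          let G = λ (w : Σ X₁ B₁) → g₁ (proj₁ w) , g₂ (proj₁ w) (proj₂ w) in
          (m ∙ cong (g₁ a ,_) d₂ ∙ cong G γ ∙ sym E₂) ∙ (E₂ ∙ cong G (sym γ ∙ cong (a ,_) d₁ ∙ γ' ∙ sym E₁) ∙ sym E₂')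
          ≡ m ∙ cong (g₁ a ,_) (d₂ ∙ cong (g₂ a) d₁) ∙ cong G γ' ∙ sym (E₂' ∙ cong G E₁)
        ·-pairing-case g₁ g₂ refl refl refl refl refl refl refl refl = refl

        pair-pairing-case :
          {X₁ X₂ : Set} {B₁ : X₁ → Set} {B₂ : X₂ → Set} {a₁ : X₁} {a₂ : X₂}
          {y₁ y₁' : B₁ a₁} {y₂ y₂' : B₂ a₂} {φ₁ w₁ w₁' : Σ X₁ B₁} {φ₂ w₂ w₂' : Σ X₂ B₂}
          (g₁ : (a₁ , y₁) ≡ φ₁) (d₁ : y₁ ≡ y₁') (c₁ : (a₁ , y₁') ≡ w₁) (E₁ : w₁' ≡ w₁)
          (g₂ : (a₂ , y₂) ≡ φ₂) (d₂ : y₂ ≡ y₂') (c₂ : (a₂ , y₂') ≡ w₂) (E₂ : w₂' ≡ w₂) →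
          cong₂ regroup (sym g₁ ∙ cong (a₁ ,_) d₁ ∙ c₁ ∙ sym E₁) (sym g₂ ∙ cong (a₂ ,_) d₂ ∙ c₂ ∙ sym E₂)
          ≡ sym (cong₂ regroup g₁ g₂) ∙ cong ((a₁ , a₂) ,_) (cong₂ _,_ d₁ d₂) ∙ cong₂ regroup c₁ c₂ ∙ sym (cong₂ regroup E₁ E₂)
        pair-pairing-case refl refl refl refl refl refl refl refl = refl

        inj-pairing-case : ∀ {ℓ ℓ'} {A : Set ℓ} {B : Set ℓ'} (f : A → B) {x y : A} (g : x ≡ y) →
                           refl ≡ sym (cong f g) ∙ refl ∙ cong f g ∙ refl
        inj-pairing-case f refl = refl

      natE-pairing : {S W : Code} (e : PE A S W) (x : ⟦ S ⟧ (car X)) →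
                     cong (split W) (ns e x)
                     ≡ sym (dfmap-split W (ev (c X) e x)) ∙ cong (ev (c X) e x ,_) (n e x)
                       ∙ cong (evΣ e) (dfmap-split S x) ∙ sym (split-ev e (fmap S s₀ x))
      natE-pairing {S} id x = id-pairing-case (dfmap-split S x)
        where
          id-pairing-case : ∀ {ℓ} {A : Set ℓ} {x y : A} (g : x ≡ y) → refl ≡ sym g ∙ refl ∙ cong (λ w → w) g ∙ refl
          id-pairing-case refl = refl
      natE-pairing {S} {W} (_·_ {Q = V} e₁ e₂) x =
        cong-∙ (split W) (ns e₂ (ev (c X) e₁ x)) (cong (ev totalC e₂) (ns e₁ x))
        ∙ cong₂ _∙_ (natE-pairing e₂ (ev (c X) e₁ x))
                    (cong-split-ev e₂ (ns e₁ x)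
                     ∙ cong (λ q → split-ev e₂ _ ∙ cong (evΣ e₂) q ∙ sym (split-ev e₂ _)) (natE-pairing e₁ x))
        ∙ ·-pairing-case (ev (c X) e₂) (dev (dc D) e₂) (sym (dfmap-split W _)) (n e₂ _) (dfmap-split V _) (split-ev e₂ _)
                         (n e₁ x) (cong (evΣ e₁) (dfmap-split S x)) (split-ev e₁ (fmap S s₀ x))
                         (split-ev e₂ (ev totalC e₁ (fmap S s₀ x)))
        ∙ cong (λ q → sym (dfmap-split W _) ∙ cong (ev (c X) e₂ (ev (c X) e₁ x) ,_) (n (e₁ · e₂) x) ∙ q
                      ∙ sym (split-ev (e₁ · e₂) (fmap S s₀ x)))
               (sym (cong-∘ (dfmap-split S x)))
      natE-pairing constr x =
        cong-id (fcu x)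
        ∙ unwhisker (fcu x) (cong (evΣ constr) (dfmap-split A x))
        ∙ cong (λ q → q ∙ cong (evΣ constr) (dfmap-split A x) ∙ refl)
               (sym (cong-pair-fibrePath (fcu-fibre x) (cong-proj₁-fcu-fibre x)))
        where
          unwhisker : ∀ {ℓ} {A : Set ℓ} {α β γ : A} (f : α ≡ β) (g : γ ≡ β) → f ≡ (f ∙ sym g) ∙ g ∙ refl
          unwhisker refl refl = refl
      natE-pairing (inl {P = P} {Q = P'}) x = inj-pairing-case (evΣ (inl {P = P} {Q = P'})) (dfmap-split P x)
      natE-pairing (inr {P = P} {Q = P'}) x = inj-pairing-case (evΣ (inr {P = P} {Q = P'})) (dfmap-split P' x)
      natE-pairing (pr₁ {P = P} {Q = P'}) x = pr₁-pairing-case (dfmap-split P (proj₁ x)) (dfmap-split P' (proj₂ x))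
        where
          pr₁-pairing-case : {u u' : ΣD P} {v v' : ΣD P'} (g₁ : u ≡ u') (g₂ : v ≡ v') →
                             refl ≡ sym g₁ ∙ refl ∙ cong (evΣ (pr₁ {P = P} {Q = P'})) (cong₂ regroup g₁ g₂) ∙ refl
          pr₁-pairing-case refl refl = refl
      natE-pairing (pr₂ {P = P} {Q = P'}) x = pr₂-pairing-case (dfmap-split P (proj₁ x)) (dfmap-split P' (proj₂ x))
        where
          pr₂-pairing-case : {u u' : ΣD P} {v v' : ΣD P'} (g₁ : u ≡ u') (g₂ : v ≡ v') →
                             refl ≡ sym g₂ ∙ refl ∙ cong (evΣ (pr₂ {P = P} {Q = P'})) (cong₂ regroup g₁ g₂) ∙ refl
          pr₂-pairing-case refl refl = refl
      natE-pairing {S} (⟨_,_⟩ {Q = W₁} {R = W₂} e₁ e₂) x =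
        cong-split-cong₂ {W₁ = W₁} {W₂ = W₂} (ns e₁ x) (ns e₂ x)
        ∙ cong₂ (cong₂ regroup) (natE-pairing e₁ x) (natE-pairing e₂ x)
        ∙ pair-pairing-case (dfmap-split W₁ _) (n e₁ x) (cong (evΣ e₁) (dfmap-split S x)) (split-ev e₁ (fmap S s₀ x))
                            (dfmap-split W₂ _) (n e₂ x) (cong (evΣ e₂) (dfmap-split S x)) (split-ev e₂ (fmap S s₀ x))
        ∙ cong (λ q → sym (cong₂ regroup (dfmap-split W₁ _) (dfmap-split W₂ _))
                      ∙ cong ((ev (c X) e₁ x , ev (c X) e₂ x) ,_) (cong₂ _,_ (n e₁ x) (n e₂ x)) ∙ q
                      ∙ sym (split-ev ⟨ e₁ , e₂ ⟩ (fmap S s₀ x)))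
               (sym (cong-pairing regroup (evΣ e₁) (evΣ e₂) (dfmap-split S x)))
      natE-pairing {S} (cst z) x = sym (cong (_∙ refl) (cong-const (dfmap-split S x)))
      natE-pairing (fm g) x = refl

      section-path-comm : ∀ j (x : ⟦ Q j ⟧ (car X)) →
                          SquareOver (Fam D) (refl {x = p X j x}) (n (l j) x) (n (r j) x)
                            (apd b₀ (p X j x)) (dp D j x (dfmap (Q j) b₀ x))
      section-path-comm j x =
        toSquareOver (p X j x) (n (l j) x) (n (r j) x) (dp D j x (dfmap (Q j) b₀ x))
          (unpaste (evΣ (l j)) (evΣ (r j)) (pathΣ j) (dfmap-split (Q j) x) (cong s₀ (p X j x))
                   (cong (ev (c X) (l j) x ,_) (n (l j) x)) (cong (ev (c X) (r j) x ,_) (n (r j) x))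
                   (split-ev (l j) (fmap (Q j) s₀ x)) (split-ev (r j) (fmap (Q j) s₀ x))
                   (cong (cong s₀ (p X j x) ∙_) (sym (ns-I (r j) x)) ∙ fpu j x
                    ∙ cong (_∙ totalP j (fmap (Q j) s₀ x)) (ns-I (l j) x)))
        where
          ns-I : ∀ {S} (e : PE A S I) (x : ⟦ S ⟧ (car X)) →
                 ns e x ≡ cong (ev (c X) e x ,_) (n e x) ∙ cong (evΣ e) (dfmap-split S x) ∙ sym (split-ev e (fmap S s₀ x))
          ns-I e x = sym (cong-id (ns e x)) ∙ natE-pairing e x

          unpaste : ∀ {ℓ ℓ'} {V : Set ℓ} {U : Set ℓ'} (F G : V → U) (H : ∀ v → F v ≡ G v) {v₀ v₁ : V} {α β ζ ζ' : U}
                    (γ : v₀ ≡ v₁) (q : α ≡ β) (dl : α ≡ F v₀) (dr : β ≡ G v₀) (El : ζ ≡ F v₁) (Er : ζ' ≡ G v₁) →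
                    q ∙ (dr ∙ cong G γ ∙ sym Er) ≡ (dl ∙ cong F γ ∙ sym El) ∙ (El ∙ H v₁ ∙ sym Er) →
                    q ∙ dr ≡ dl ∙ H v₀
          unpaste F G H refl q refl refl refl refl sq = sq ∙ trans-reflʳ _

          toSquareOver : {t₁ t₂ : car X} (q : t₁ ≡ t₂) {β₁ : Fam D t₁} {β₂ : Fam D t₂}
                         (dl : b₀ t₁ ≡ β₁) (dr : b₀ t₂ ≡ β₂) (o : PathOver (Fam D) q β₁ β₂) →
                         cong s₀ q ∙ cong (t₂ ,_) dr ≡ cong (t₁ ,_) dl ∙ ΣPath q o →
                         SquareOver (Fam D) refl dl dr (apd b₀ q) o
          toSquareOver refl refl refl o e = cong-pair-injective refl o e

      section : Section Σs D
      section = record { sec = b₀ ; secc = section-comm ; secp = section-path-comm }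

module _ (ua : ∀ {ℓ} → Univalence ℓ) (Σs : Signature) (X : Alg Σs) where
  open Signature Σs
  open FunExt (ua {lzero})

  HIT→biinitial : isHIT Σs X → isBiinitial Σs X
  HIT→biinitial hit =
    (λ Y → section→cell₁ Y (hit (constDispAlg Y)))
    , (λ Y f g → section→cell₂ Y f g (hit (pathDispAlg Y f g)))
    , (λ Y f g α β → section→≡ Y α β (hit (eqDispAlg Y α β)))
    where
      open ConstantDisplayedAlgebra Σs X
      open PathDisplayedAlgebra Σs X
      open EqualityDisplayedAlgebra (ua {lzero}) Σs X

  -- Biinitiality gives u : X → Σ X D and a 2-cell from proj₁ ∘ u to the identity; homotopy
  -- induction along it reduces to the case where proj₁ ∘ u is the identity on the nose.
  biinitial→HIT : isBiinitial Σs X → isHIT Σs X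
  biinitial→HIT (cell₁ , cell₂ , _) D =
    htpyInd CellOver fromCellOverId
      (λ x → proj₁ (fun u x)) (θ θ₂) (λ x → proj₂ (fun u x)) (fc u) (fp u) (θc θ₂)
    where
      open TotalAlgebra Σs X D

      u : Cell1 Σs X totalAlg
      u = cell₁ totalAlg

      θ₂ : Cell2 Σs (u ·₁ projCell) (idCell₁ X)
      θ₂ = cell₂ X (u ·₁ projCell) (idCell₁ X)

      CellOver : (a : car X → car X) → (∀ x → a x ≡ x) → Set
      CellOver a θ' =
        (b : ∀ x → Fam D (a x))
        (fcu : ∀ x → _≡_ {A = TX} (a (c X x) , b (c X x)) (totalC (fmap A (λ x → a x , b x) x)))
        (fpu : ∀ j (x : ⟦ Q j ⟧ (car X)) →
               trans (cong (λ x → a x , b x) (p X j x)) (natE (c X) totalC (λ x → a x , b x) fcu (r j) x)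
               ≡ trans (natE (c X) totalC (λ x → a x , b x) fcu (l j) x) (totalP j (fmap (Q j) (λ x → a x , b x) x))) →
        let v : Cell1 Σs X totalAlg
            v = record { fun = λ x → a x , b x ; fc = fcu ; fp = fpu } in
        (∀ x → trans (θ' (c X x)) (fc (idCell₁ X) x) ≡ trans (fc (v ·₁ projCell) x) (cong (c X) (fmapH A θ' x))) →
        Section Σs D

      fromCellOverId : CellOver (λ x → x) (λ _ → refl)
      fromCellOverId b fcu fpu θc' = SectionFromCell.section b fcu fpu λ x →
        sym (trans-reflʳ (comm x)) ∙ cong (λ q → comm x ∙ cong (c X) q) (sym (fmapH-refl A x)) ∙ sym (θc' x)
        where
          comm : ∀ x → c X x ≡ c X (fmap A (λ x → x) x)
          comm = fc (SectionFromCell.u b fcu fpu ·₁ projCell)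

proposition4p17 : (ua : ∀ {ℓ} → Univalence ℓ) (Σs : Signature) (X : Alg Σs) →
    isHIT Σs X ⇔ isBiinitial Σs X
proposition4p17 ua Σs X = mk⇔ (HIT→biinitial ua Σs X) (biinitial→HIT ua Σs X)
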